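{- Let $n\ge2$. There is a commutative diagram $$\begin{array}{ccccccccc}0&\to& I_n^{1',1}&\hookrightarrow&\Sigma(D_n)&\xrightarrow{\gamma}&\Sigma(B_{n-2})&\to&0\\ &&\downarrow\psi&&\downarrow\psi&&\downarrow\varphi&&\\ 0&\to&\mathring{\mathfrak P}_n&\hookrightarrow&\mathfrak P_n&\xrightarrow{\pi}&\mathfrak P_{n-2}&\to&0\end{array}$$ in which both rows are exact and the three vertical maps are surjective.
   Context: Notation: $[m]=\{1,\dots,m\}$; for a set $J$ of integers, $J-k=\{j-k:j\in J\}$. Type B: $\mathcal B_m$ is the group of signed permutations (bijections $w$ of $\{\pm1,\dots,\pm m\}$ with $w(-i)=-w(i)$), written $w_1\cdots w_m$, entries ordered $\cdots<\bar2<\bar1<1<2<\cdots$ ($\bar k=-k$); $\mathrm{Des}(w)=\{i\in\{0,\dots,m-1\}:w_i>w_{i+1}\}$ with $w_0=0$; for $J\subseteq\{0,\dots,m-1\}$, $Y_J=\sum_{\mathrm{Des}(w)=J}w$, $X_J=\sum_{I\subseteq J}Y_I$, and $\Sigma(B_m)$ is their span. Type D: $\mathcal D_n\subseteq\mathcal B_n$ consists of signed permutations with an even number of negative entries; for $w\in\mathcal D_n$, $\mathrm{Des}(w)\subseteq\{1',1,\dots,n-1\}$ where $w$ has a descent at $i\in[n-1]$ iff $w_i>w_{i+1}$ and at $1'$ iff $-w_1>w_2$. For $J\subseteq\{1',1,\dots,n-1\}$, $Y_J=\sum_{w\in\mathcal D_n,\mathrm{Des}(w)=J}w$, $X_J=\sum_{I\subseteq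 J}Y_I$; $\Sigma(D_n)$ is their span (Solomon's descent algebra of type D). $\gamma:\Sigma(D_n)\to\Sigma(B_{n-2})$ is the linear map with $X_J\mapsto X_{J-2}$ if $1,1'\notin J$ (so $J\subseteq\{2,\dots,n-1\}$ and $J-2\subseteq\{0,\dots,n-3\}$) and $X_J\mapsto0$ if $1\in J$ or $1'\in J$. $I_n^{1',1}=\mathrm{Span}\{X_J: 1\in J\text{ or }1'\in J\}\subseteq\Sigma(D_n)$. $\varphi$ is the linear map forgetting signs, $w\mapsto|w_1|\cdots|w_m|$, and $\psi$ its restriction to $\mathbb Q\mathcal D_n$. Type A: for $w\in\mathcal S_n$, $\mathrm{Peak}(w)=\{i\in[n-1]:w_{i-1}<w_i>w_{i+1}\}$ with $w_0=0$; $\mathring{\mathrm{Peak}}(w)=\mathrm{Peak}(w)\setminus\{1\}$. $\mathcal F_n$: subsets of $[n-1]$ without two consecutive integers; $\mathring{\mathcal F}_n=\{F\in\mathcal F_n:1\notin F\}$. $P_F=\sum_{\mathrm{Peak}(w)=F}w$, $\mathring P_F=\sum_{\mathring{\mathrm{Peak}}(w)=F}w$; $\mathfrak P_n=\mathrm{Span}\{P_F:F\in\mathcal F_n\}$, $\mathring{\mathfrak P}_n=\mathrm{Span}\{\mathring P_F:F\in\mathring{\mathcal F}_n\}$, $\mathfrak P_0=\mathbb Q$. $\pi:\mathfrak P_n\to\mathfrak P_{n-2}$ is linear with $P_F\mapsto P_{F-2}$ if $1,2\notin F$; $P_F\mapsto-P_{(F\setminus\{1\})-2}$ if $1\in F$;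 $P_F\mapsto0$ if $2\in F$. -}

module Defs where

open import Data.Bool using (Bool; true; false; _∧_; _∨_; not; if_then_else_; T)
open import Data.Nat as ℕ using (ℕ; zero; suc; pred)
open import Data.Fin using (Fin; toℕ)
open import Data.Integer as ℤ using (ℤ; +_; -[1+_])
open import Data.Rational as ℚ using (ℚ; 0ℚ; 1ℚ)
open import Data.List as List using (List; []; _∷_; filter)
open import Data.Vec as Vec using (Vec; []; _∷_; allFin)
open import Data.Product using (Σ; ∃; _×_; _,_)
open import Relation.Binary.PropositionalEquality using (_≡_)
open import Relation.Nullary.Decidable using (Dec)
open import Data.Bool.Properties using (T?)

-- all Boolean vectors of length k (= all subsets of a k-element index set)
allVecs : (k : ℕ) → List (Vec Bool k)
allVecs zero    = [] ∷ []
allVecs (suc k) = List.map (true ∷_) (allVecs k) List.++ List.map (false ∷_) (allVecs k)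

_⊆ᵇ_ : {k : ℕ} → Vec Bool k → Vec Bool k → Bool
[] ⊆ᵇ [] = true
(a ∷ I) ⊆ᵇ (b ∷ J) = (not a ∨ b) ∧ (I ⊆ᵇ J)

_≡ᵇᵥ_ : {k : ℕ} → Vec Bool k → Vec Bool k → Bool
I ≡ᵇᵥ J = (I ⊆ᵇ J) ∧ (J ⊆ᵇ I)

boolℚ : Bool → ℚ
boolℚ true  = 1ℚ
boolℚ false = 0ℚ

sumℚ : List ℚ → ℚ
sumℚ = List.foldr ℚ._+_ 0ℚ

lc : {I G : Set} → List I → (I → ℚ) → (I → G → ℚ) → G → ℚ
lc idx c e g = sumℚ (List.map (λ i → c i ℚ.* e i g) idx)

-- Permutations and (signed) permutations, and their group algebras over ℚ
-- An element of the group algebra ℚG is a function G → ℚ (coefficients);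
-- since G is finite this is exactly the group algebra as a vector space.

-- one-line notation u₁⋯uₙ (values 0..n-1 standing for 1..n) is a permutation
isPermᵇ : {n : ℕ} → Vec (Fin n) n → Bool
isPermᵇ {n} v = Vec.foldr _ (λ i acc → Vec.foldr _ (λ j b → (toℕ i ℕ.≡ᵇ toℕ j) ∨ b) false v ∧ acc) true (allFin n)

record Perm (n : ℕ) : Set where
  constructor perm
  field
    word  : Vec (Fin n) n
    valid : T (isPermᵇ word)
open Perm public

-- signed permutation of B_m: underlying permutation |w| and signs (true = negative)
record SPerm (m : ℕ) : Set where
  constructor sperm
  field
    abs   : Perm m
    signs : Vec Bool m
open SPerm public

countTrue : {k : ℕ} → Vec Bool k → ℕ
countTrue = Vec.foldr _ (λ b n → if b then suc n else n) 0

evenᵇ : ℕ → Bool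
evenᵇ zero = true
evenᵇ (suc n) = not (evenᵇ n)

record DPerm (n : ℕ) : Set where
  constructor dperm
  field
    absD   : Perm n
    signsD : Vec Bool n
    even   : T (evenᵇ (countTrue signsD))
open DPerm public

-- the entries w₁ ⋯ wₘ as integers (w_i = ±(u_i + 1))
entries : {m : ℕ} → Perm m → Vec Bool m → Vec ℤ m
entries u ε = Vec.zipWith (λ s i → if s then -[1+ toℕ i ] else + suc (toℕ i)) ε (word u)

_>ᵇ_ : ℤ → ℤ → Bool
x >ᵇ y = not (x ℤ.≤ᵇ y)

descentsFrom : {k : ℕ} → ℤ → Vec ℤ k → Vec Bool k
descentsFrom p [] = []
descentsFrom p (x ∷ xs) = (p >ᵇ x) ∷ descentsFrom x xs

-- type B descent set ⊆ {0,…,m-1}, entry i ↔ i, with w₀ = 0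
DesB : {m : ℕ} → SPerm m → Vec Bool m
DesB w = descentsFrom (+ 0) (entries (abs w) (signs w))

-- type D descent set ⊆ {1',1,…,n-1}, encoded as a vector of length n:
-- entry 0 ↔ 1', entry i ↔ i (1 ≤ i ≤ n-1).  (Only used for n ≥ 2.)
desDvec : {n : ℕ} → Vec ℤ n → Vec Bool n
desDvec [] = []
desDvec (x ∷ []) = false ∷ []
desDvec (x ∷ y ∷ xs) = ((ℤ.- x) >ᵇ y) ∷ descentsFrom x (y ∷ xs)

DesD : {n : ℕ} → DPerm n → Vec Bool n
DesD w = desDvec (entries (absD w) (signsD w))

YB : {m : ℕ} → Vec Bool m → SPerm m → ℚ
YB J w = boolℚ (DesB w ≡ᵇᵥ J)

XB : {m : ℕ} → Vec Bool m → SPerm m → ℚ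
XB {m} J w = sumℚ (List.map (λ I → if I ⊆ᵇ J then YB I w else 0ℚ) (allVecs m))

YD : {n : ℕ} → Vec Bool n → DPerm n → ℚ
YD J w = boolℚ (DesD w ≡ᵇᵥ J)

XD : {n : ℕ} → Vec Bool n → DPerm n → ℚ
XD {n} J w = sumℚ (List.map (λ I → if I ⊆ᵇ J then YD I w else 0ℚ) (allVecs n))

-- Peak sets: subsets of [n-1] encoded as Vec Bool (pred n), entry i ↔ i+1.
peaksFrom : {n : ℕ} → ℕ → Vec ℕ n → Vec Bool (pred n)
peaksFrom p [] = []
peaksFrom p (x ∷ []) = []
peaksFrom p (x ∷ y ∷ xs) = ((p ℕ.<ᵇ x) ∧ (y ℕ.<ᵇ x)) ∷ peaksFrom x (y ∷ xs)

Peak : {n : ℕ} → Perm n → Vec Bool (pred n)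
Peak u = peaksFrom 0 (Vec.map (λ i → suc (toℕ i)) (word u))

remove1 : {k : ℕ} → Vec Bool k → Vec Bool k
remove1 [] = []
remove1 (a ∷ F) = false ∷ F

PeakRing : {n : ℕ} → Perm n → Vec Bool (pred n)
PeakRing u = remove1 (Peak u)

noConsec : {k : ℕ} → Vec Bool k → Bool
noConsec [] = true
noConsec (a ∷ []) = true
noConsec (a ∷ b ∷ F) = not (a ∧ b) ∧ noConsec (b ∷ F)

has1 : {k : ℕ} → Vec Bool k → Bool
has1 [] = false
has1 (a ∷ F) = a

has2 : {k : ℕ} → Vec Bool k → Bool
has2 [] = false
has2 (a ∷ []) = false
has2 (a ∷ b ∷ F) = b

𝓕 : (n : ℕ) → List (Vec Bool (pred n))
𝓕 n = filter (λ F → T? (noConsec F)) (allVecs (pred n))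

𝓕̊ : (n : ℕ) → List (Vec Bool (pred n))
𝓕̊ n = filter (λ F → T? (noConsec F ∧ not (has1 F))) (allVecs (pred n))

PP : {n : ℕ} → Vec Bool (pred n) → Perm n → ℚ
PP F u = boolℚ (Peak u ≡ᵇᵥ F)

PR : {n : ℕ} → Vec Bool (pred n) → Perm n → ℚ
PR F u = boolℚ (PeakRing u ≡ᵇᵥ F)

_≈_ : {G : Set} → (G → ℚ) → (G → ℚ) → Set
x ≈ y = ∀ g → x g ≡ y g

zeroV : {G : Set} → G → ℚ
zeroV _ = 0ℚ

InΣB : (m : ℕ) → (SPerm m → ℚ) → Set
InΣB m y = ∃ λ (c : Vec Bool m → ℚ) → y ≈ lc (allVecs m) c XB

InΣD : (n : ℕ) → (DPerm n → ℚ) → Set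
InΣD n x = ∃ λ (c : Vec Bool n → ℚ) → x ≈ lc (allVecs n) c XD

has1'or1 : {n : ℕ} → Vec Bool n → Bool
has1'or1 [] = false
has1'or1 (a ∷ []) = a
has1'or1 (a ∷ b ∷ J) = a ∨ b

idxI : (n : ℕ) → List (Vec Bool n)
idxI n = filter (λ J → T? (has1'or1 J)) (allVecs n)

InI : (n : ℕ) → (DPerm n → ℚ) → Set
InI n x = ∃ λ (c : Vec Bool n → ℚ) → x ≈ lc (idxI n) c XD

Inℙ : (n : ℕ) → (Perm n → ℚ) → Set
Inℙ n z = ∃ λ (c : Vec Bool (pred n) → ℚ) → z ≈ lc (𝓕 n) c PP

Inℙ̊ : (n : ℕ) → (Perm n → ℚ) → Set
Inℙ̊ n z = ∃ λ (c : Vec Bool (pred n) → ℚ) → z ≈ lc (𝓕̊ n) c PR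

φ : {m : ℕ} → (SPerm m → ℚ) → Perm m → ℚ
φ {m} x u = sumℚ (List.map (λ ε → x (sperm u ε)) (allVecs m))

evenTerm : {n : ℕ} → (DPerm n → ℚ) → Perm n → (ε : Vec Bool n) → Dec (T (evenᵇ (countTrue ε))) → ℚ
evenTerm x u ε (Relation.Nullary.Decidable.yes p) = x (dperm u ε p)
evenTerm x u ε (Relation.Nullary.Decidable.no _)  = 0ℚ

ψ : {n : ℕ} → (DPerm n → ℚ) → Perm n → ℚ
ψ {n} x u = sumℚ (List.map (λ ε → evenTerm x u ε (T? (evenᵇ (countTrue ε)))) (allVecs n))

-- γ(X_J) for J ⊆ {1',1,2,…,m+1}: J = (1'∈J, 1∈J, J ∩ {2,…,m+1}); the last part shifted by -2
γX : (m : ℕ) → Vec Bool (suc (suc m)) → SPerm m → ℚ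
γX m (a ∷ b ∷ J) = if a ∨ b then zeroV else XB J

-- F ↦ (F ∖ {1,2}) - 2 for F ⊆ [m+1], giving a subset of [m-1]
drop2 : {m : ℕ} → Vec Bool (suc m) → Vec Bool (pred m)
drop2 {zero}  (a ∷ [])    = []
drop2 {suc k} (a ∷ b ∷ F) = F

πP : (m : ℕ) → Vec Bool (suc m) → Perm m → ℚ
πP m F = if has2 F then zeroV
         else (if has1 F then (λ u → ℚ.- (PP {m} (drop2 F) u)) else PP {m} (drop2 F))

-- The content of Theorem 5.12 for n = m + 2

record Diagram (m : ℕ) : Set where
  field
    γ      : (DPerm (suc (suc m)) → ℚ) → SPerm m → ℚ
    γ-cong : ∀ x x' → x ≈ x' → γ x ≈ γ x'
    γ-def  : ∀ (c : Vec Bool (suc (suc m)) → ℚ) →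
               γ (lc (allVecs (suc (suc m))) c XD) ≈ lc (allVecs (suc (suc m))) c (γX m)
    π      : (Perm (suc (suc m)) → ℚ) → Perm m → ℚ
    π-cong : ∀ z z' → z ≈ z' → π z ≈ π z'
    π-def  : ∀ (c : Vec Bool (suc m) → ℚ) →
               π (lc (𝓕 (suc (suc m))) c PP) ≈ lc (𝓕 (suc (suc m))) c (πP m)
    I⊆ΣD      : ∀ x → InI (suc (suc m)) x → InΣD (suc (suc m)) x
    γ-ker→I   : ∀ x → InΣD (suc (suc m)) x → γ x ≈ zeroV → InI (suc (suc m)) x
    I→γ-ker   : ∀ x → InI (suc (suc m)) x → γ x ≈ zeroV
    γ-into    : ∀ x → InΣD (suc (suc m)) x → InΣB m (γ x)
    γ-onto    : ∀ y → InΣB m y → ∃ λ x → InΣD (suc (suc m)) x × γ x ≈ y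
    ℙ̊⊆ℙ       : ∀ z → Inℙ̊ (suc (suc m)) z → Inℙ (suc (suc m)) z
    π-ker→ℙ̊   : ∀ z → Inℙ (suc (suc m)) z → π z ≈ zeroV → Inℙ̊ (suc (suc m)) z
    ℙ̊→π-ker   : ∀ z → Inℙ̊ (suc (suc m)) z → π z ≈ zeroV
    π-into    : ∀ z → Inℙ (suc (suc m)) z → Inℙ m (π z)
    π-onto    : ∀ z → Inℙ m z → ∃ λ w → Inℙ (suc (suc m)) w × π w ≈ z
    ψI-into   : ∀ x → InI (suc (suc m)) x → Inℙ̊ (suc (suc m)) (ψ x)
    ψI-onto   : ∀ z → Inℙ̊ (suc (suc m)) z → ∃ λ x → InI (suc (suc m)) x × ψ x ≈ z
    ψΣ-into   : ∀ x → InΣD (suc (suc m)) x → Inℙ (suc (suc m)) (ψ x)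
    ψΣ-onto   : ∀ z → Inℙ (suc (suc m)) z → ∃ λ x → InΣD (suc (suc m)) x × ψ x ≈ z
    φ-into    : ∀ y → InΣB m y → Inℙ m (φ y)
    φ-onto    : ∀ z → Inℙ m z → ∃ λ y → InΣB m y × φ y ≈ z
    -- right square commutes (the left square commutes trivially: both maps are ψ)
    square    : ∀ x → InΣD (suc (suc m)) x → π (ψ x) ≈ φ (γ x)

{-# OPTIONS --safe #-}
-- All maps are evaluated at a single permutation u, where everything becomes a count of sign vectors.
-- Between neighbouring signed entries only the sign of the one of larger absolute value matters, so by
-- induction along u, φ(X_K)(u) is 2^|K| if every peak of u lies in K or right after an element of K and 0
-- otherwise; ψ(X_J)(u) is computed in the same way, using that the signed count vanishes, so that a count
-- restricted to sign vectors of even parity is half of the full count. Hence φ and ψ land in the peak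
-- algebras, and they are onto because these coverage indicators span all functions on peak sets.
-- The maps γ and π are realised by evaluating at lifts of a permutation v of size n - 2:
-- π(z)(v) = z(1 2 (v+2)) - z(2 1 (v+2)), and γ is an inclusion–exclusion over four lifts to D_n. Exactness
-- then reduces to the linear independence of the indicators of {K ⊇ L} and to the fact that every set
-- without two consecutive integers is the peak set of some permutation.
module Submission where

open import Defs
open import Data.Nat using (ℕ; zero; suc; pred; _≡ᵇ_; _<ᵇ_; _≤ᵇ_; _≤_; _<_; z≤n; s≤s)

open import Data.Bool using (Bool; true; false; not; _∧_; _∨_; _xor_; if_then_else_; T)
open import Data.Bool.Properties using (T?; T-≡; T-∧; T-∨; ¬-not; not-involutive; ∨-assoc; ∨-comm; ∨-zeroʳ; ∧-zeroʳ; ∧-identityʳ)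
open import Data.Fin as Fin using (Fin; toℕ)
open import Data.Fin.Properties using (toℕ-injective; injective⇒≤)
open import Data.Integer as ℤ using (ℤ; -[1+_])
open import Data.List as List using (List; []; _∷_; _++_; filter; length)
open import Data.List.Membership.Propositional using (_∈_)
open import Data.List.Membership.Propositional.Properties using (∈-++⁺ˡ; ∈-++⁺ʳ; ∈-++⁻)
open import Data.List.Properties using (length-++-sucʳ; ++-assoc)
open import Data.List.Relation.Unary.Any using (here; there; index)
open import Data.List.Relation.Unary.Any.Properties using (lookup-index)
import Data.Nat.Properties as ℕ
open import Data.Product using (Σ; ∃; _×_; _,_; proj₁; proj₂)
open import Data.Sum using (inj₁; inj₂; [_,_])
open import Data.Unit using (tt)
open import Data.Rational using (ℚ; 0ℚ; 1ℚ; ½; _+_; _*_; -_; _-_)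
import Data.Rational.Properties as ℚ
open import Data.Rational.Solver using (module +-*-Solver)
open import Algebra.Properties.Group ℚ.+-0-group using (x∙y⁻¹≈ε⇒x≈y)
open import Data.Vec as Vec using (Vec; []; _∷_; toList)
open import Data.Vec.Properties using (map-∘; length-toList)
open import Data.Vec.Relation.Unary.Linked as Linked using (Linked; []; [-]; _∷_)
open import Data.Vec.Relation.Unary.Linked.Properties using (map⁺)
open import Function using (_∘_; id)
open import Function.Bundles using (_⇔_; mk⇔; Equivalence)
open import Relation.Binary.Definitions using (Tri; tri<; tri≈; tri>)
open import Relation.Nullary using (¬_; Dec; yes; no)
open import Data.Empty using (⊥-elim)
open import Relation.Binary.PropositionalEquality hiding ([_]; J)

open +-*-Solver
open ≡-Reasoning

-- Finite sums

private
  variable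
    A B : Set

∑ : List A → (A → ℚ) → ℚ
∑ xs f = sumℚ (List.map f xs)

infix 5 ∑
syntax ∑ xs (λ x → e) = ∑[ x ← xs ] e

∑-++ : (xs ys : List A) (f : A → ℚ) → ∑ (xs ++ ys) f ≡ ∑ xs f + ∑ ys f
∑-++ []       ys f = sym (ℚ.+-identityˡ _)
∑-++ (x ∷ xs) ys f = trans (cong (f x +_) (∑-++ xs ys f)) (sym (ℚ.+-assoc (f x) _ _))

∑-map : (g : B → A) (xs : List B) (f : A → ℚ) → ∑ (List.map g xs) f ≡ ∑ xs (f ∘ g)
∑-map g []       f = refl
∑-map g (x ∷ xs) f = cong (f (g x) +_) (∑-map g xs f)

∑-cong : (xs : List A) {f g : A → ℚ} → (∀ x → f x ≡ g x) → ∑ xs f ≡ ∑ xs g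
∑-cong []       f≗g = refl
∑-cong (x ∷ xs) f≗g = cong₂ _+_ (f≗g x) (∑-cong xs f≗g)

∑-zero : (xs : List A) {f : A → ℚ} → (∀ x → f x ≡ 0ℚ) → ∑ xs f ≡ 0ℚ
∑-zero []       f≗0 = refl
∑-zero (x ∷ xs) f≗0 = trans (cong₂ _+_ (f≗0 x) (∑-zero xs f≗0)) (ℚ.+-identityˡ 0ℚ)

∑-+ : (xs : List A) (f g : A → ℚ) → ∑[ x ← xs ] (f x + g x) ≡ ∑ xs f + ∑ xs g
∑-+ []       f g = refl
∑-+ (x ∷ xs) f g = trans (cong (f x + g x +_) (∑-+ xs f g))
  (solve 4 (λ a b c d → (a :+ b) :+ (c :+ d) := (a :+ c) :+ (b :+ d)) refl (f x) (g x) (∑ xs f) (∑ xs g))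

∑-- : (xs : List A) (f g : A → ℚ) → ∑[ x ← xs ] (f x - g x) ≡ ∑ xs f - ∑ xs g
∑-- []       f g = refl
∑-- (x ∷ xs) f g = trans (cong (f x - g x +_) (∑-- xs f g))
  (solve 4 (λ a b c d → (a :- b) :+ (c :- d) := (a :+ c) :- (b :+ d)) refl (f x) (g x) (∑ xs f) (∑ xs g))

∑-*ˡ : (xs : List A) (c : ℚ) (f : A → ℚ) → ∑[ x ← xs ] (c * f x) ≡ c * ∑ xs f
∑-*ˡ []       c f = sym (ℚ.*-zeroʳ c)
∑-*ˡ (x ∷ xs) c f = trans (cong (c * f x +_) (∑-*ˡ xs c f)) (sym (ℚ.*-distribˡ-+ c (f x) _))

∑-comm : (xs : List A) (ys : List B) (f : A → B → ℚ) →
         ∑[ x ← xs ] ∑[ y ← ys ] f x y ≡ ∑[ y ← ys ] ∑[ x ← xs ] f x y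
∑-comm []       ys f = sym (∑-zero ys (λ _ → refl))
∑-comm (x ∷ xs) ys f = trans (cong (∑ ys (f x) +_) (∑-comm xs ys f)) (sym (∑-+ ys (f x) _))

∑-filter : (xs : List A) (P : A → Bool) (f : A → ℚ) →
           ∑ (filter (T? ∘ P) xs) f ≡ ∑[ x ← xs ] (if P x then f x else 0ℚ)
∑-filter []       P f = refl
∑-filter (x ∷ xs) P f with P x
... | true  = cong (f x +_) (∑-filter xs P f)
... | false = trans (∑-filter xs P f) (sym (ℚ.+-identityˡ _))

∑-neg : (xs : List A) (f : A → ℚ) → ∑[ x ← xs ] (- f x) ≡ - ∑ xs f
∑-neg []       f = refl
∑-neg (x ∷ xs) f = trans (cong (- f x +_) (∑-neg xs f)) (sym (ℚ.neg-distrib-+ (f x) _))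

∑-allVecs-suc : (k : ℕ) (f : Vec Bool (suc k) → ℚ) →
  ∑ (allVecs (suc k)) f ≡ (∑[ v ← allVecs k ] f (true ∷ v)) + (∑[ v ← allVecs k ] f (false ∷ v))
∑-allVecs-suc k f = trans (∑-++ (List.map (true ∷_) (allVecs k)) _ f)
  (cong₂ _+_ (∑-map (true ∷_) (allVecs k) f) (∑-map (false ∷_) (allVecs k) f))

∑-allVecs-2+ : (k : ℕ) (f : Vec Bool (suc (suc k)) → ℚ) →
  ∑ (allVecs (suc (suc k))) f
  ≡ ((∑[ v ← allVecs k ] f (true ∷ true ∷ v)) + (∑[ v ← allVecs k ] f (true ∷ false ∷ v)))
    + ((∑[ v ← allVecs k ] f (false ∷ true ∷ v)) + (∑[ v ← allVecs k ] f (false ∷ false ∷ v)))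
∑-allVecs-2+ k f = trans (∑-allVecs-suc (suc k) f) (cong₂ _+_ (∑-allVecs-suc k (f ∘ (true ∷_))) (∑-allVecs-suc k (f ∘ (false ∷_))))

-- Indicator functions of subsets

if-as-boolℚ : (b : Bool) (q : ℚ) → (if b then q else 0ℚ) ≡ boolℚ b * q
if-as-boolℚ true  q = sym (ℚ.*-identityˡ q)
if-as-boolℚ false q = sym (ℚ.*-zeroˡ q)

if-*ʳ : (b : Bool) (q e : ℚ) → (if b then q * e else 0ℚ) ≡ (if b then q else 0ℚ) * e
if-*ʳ true  q e = refl
if-*ʳ false q e = sym (ℚ.*-zeroˡ e)

∑-boolℚ-∧ : (xs : List A) (b : Bool) (f : A → Bool) →
            ∑[ x ← xs ] boolℚ (b ∧ f x) ≡ (if b then ∑[ x ← xs ] boolℚ (f x) else 0ℚ)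
∑-boolℚ-∧ xs true  f = refl
∑-boolℚ-∧ xs false f = ∑-zero xs (λ _ → refl)

∑-weighted-∧ : (xs : List A) (w : A → ℚ) (b : Bool) (f : A → Bool) →
               ∑[ x ← xs ] w x * boolℚ (b ∧ f x) ≡ (if b then ∑[ x ← xs ] w x * boolℚ (f x) else 0ℚ)
∑-weighted-∧ xs w true  f = refl
∑-weighted-∧ xs w false f = ∑-zero xs (λ x → ℚ.*-zeroʳ (w x))

≡ᵇᵥ-∷ : {k : ℕ} (a b : Bool) (I J : Vec Bool k) → ((a ∷ I) ≡ᵇᵥ (b ∷ J)) ≡ not (a xor b) ∧ (I ≡ᵇᵥ J)
≡ᵇᵥ-∷ true  true  I J = refl
≡ᵇᵥ-∷ true  false I J = refl
≡ᵇᵥ-∷ false true  I J = ∧-zeroʳ (I ⊆ᵇ J)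
≡ᵇᵥ-∷ false false I J = refl

∑-δ : (k : ℕ) (h : Vec Bool k → ℚ) (G : Vec Bool k) → ∑[ F ← allVecs k ] h F * boolℚ (G ≡ᵇᵥ F) ≡ h G
∑-δ zero    h []      = trans (ℚ.+-identityʳ _) (ℚ.*-identityʳ _)
∑-δ (suc k) h (g ∷ G) = begin
    ∑[ F ← allVecs (suc k) ] h F * boolℚ ((g ∷ G) ≡ᵇᵥ F)
  ≡⟨ ∑-allVecs-suc k _ ⟩
    headed true + headed false
  ≡⟨ cong₂ _+_ (headed≡ true) (headed≡ false) ⟩
    (if not (g xor true) then h (true ∷ G) else 0ℚ) + (if not (g xor false) then h (false ∷ G) else 0ℚ)
  ≡⟨ pick g ⟩
    h (g ∷ G)
  ∎
  where
  headed : Bool → ℚ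
  headed f = ∑[ F ← allVecs k ] h (f ∷ F) * boolℚ ((g ∷ G) ≡ᵇᵥ (f ∷ F))
  headed≡ : ∀ f → headed f ≡ (if not (g xor f) then h (f ∷ G) else 0ℚ)
  headed≡ f = trans (∑-cong (allVecs k) (λ F → cong (λ b → h (f ∷ F) * boolℚ b) (≡ᵇᵥ-∷ g f G F))) (by (not (g xor f)))
    where
    by : ∀ c → ∑[ F ← allVecs k ] h (f ∷ F) * boolℚ (c ∧ (G ≡ᵇᵥ F)) ≡ (if c then h (f ∷ G) else 0ℚ)
    by true  = ∑-δ k (h ∘ (f ∷_)) G
    by false = ∑-zero (allVecs k) (λ F → ℚ.*-zeroʳ (h (f ∷ F)))
  pick : ∀ g → (if not (g xor true) then h (true ∷ G) else 0ℚ) + (if not (g xor false) then h (false ∷ G) else 0ℚ)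
               ≡ h (g ∷ G)
  pick true  = ℚ.+-identityʳ _
  pick false = ℚ.+-identityˡ _

X-apply : {k : ℕ} (J D : Vec Bool k) →
          sumℚ (List.map (λ I → if I ⊆ᵇ J then boolℚ (D ≡ᵇᵥ I) else 0ℚ) (allVecs k)) ≡ boolℚ (D ⊆ᵇ J)
X-apply {k} J D = trans (∑-cong (allVecs k) (λ I → if-as-boolℚ (I ⊆ᵇ J) _)) (∑-δ k (λ I → boolℚ (I ⊆ᵇ J)) D)

XB-apply : {m : ℕ} (J : Vec Bool m) (w : SPerm m) → XB J w ≡ boolℚ (DesB w ⊆ᵇ J)
XB-apply J w = X-apply J (DesB w)

XD-apply : {n : ℕ} (J : Vec Bool n) (w : DPerm n) → XD J w ≡ boolℚ (DesD w ⊆ᵇ J)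
XD-apply J w = X-apply J (DesD w)

lc-filter : {I G : Set} (xs : List I) (P : I → Bool) (c : I → ℚ) (e : I → G → ℚ) →
            lc (filter (T? ∘ P) xs) c e ≈ lc xs (λ i → if P i then c i else 0ℚ) e
lc-filter xs P c e g = trans (∑-filter xs P (λ i → c i * e i g)) (∑-cong xs (λ i → if-*ʳ (P i) (c i) (e i g)))

zeta-injective : (m : ℕ) (d : Vec Bool m → ℚ) → (∀ L → ∑[ K ← allVecs m ] d K * boolℚ (L ⊆ᵇ K) ≡ 0ℚ) → ∀ K → d K ≡ 0ℚ
zeta-injective zero    d zeta≡0 [] = trans (sym (trans (ℚ.+-identityʳ _) (ℚ.*-identityʳ (d [])))) (zeta≡0 [])
zeta-injective (suc m) d zeta≡0 = by-head
  where
  true-headed : ∀ K → d (true ∷ K) ≡ 0ℚ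
  true-headed = zeta-injective m (d ∘ (true ∷_)) λ L → begin
      ∑[ K ← allVecs m ] d (true ∷ K) * boolℚ (L ⊆ᵇ K)
    ≡⟨ sym (ℚ.+-identityʳ (∑[ K ← allVecs m ] d (true ∷ K) * boolℚ (L ⊆ᵇ K))) ⟩
      (∑[ K ← allVecs m ] d (true ∷ K) * boolℚ (L ⊆ᵇ K)) + 0ℚ
    ≡⟨ cong ((∑[ K ← allVecs m ] d (true ∷ K) * boolℚ (L ⊆ᵇ K)) +_) (sym (∑-zero (allVecs m) (λ K → ℚ.*-zeroʳ (d (false ∷ K))))) ⟩
      (∑[ K ← allVecs m ] d (true ∷ K) * boolℚ (L ⊆ᵇ K)) + (∑[ K ← allVecs m ] d (false ∷ K) * 0ℚ)
    ≡⟨ sym (∑-allVecs-suc m _) ⟩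
      ∑[ K ← allVecs (suc m) ] d K * boolℚ ((true ∷ L) ⊆ᵇ K)
    ≡⟨ zeta≡0 (true ∷ L) ⟩
      0ℚ
    ∎
  false-headed : ∀ K → d (false ∷ K) ≡ 0ℚ
  false-headed = zeta-injective m (d ∘ (false ∷_)) λ L → begin
      ∑[ K ← allVecs m ] d (false ∷ K) * boolℚ (L ⊆ᵇ K)
    ≡⟨ sym (ℚ.+-identityˡ (∑[ K ← allVecs m ] d (false ∷ K) * boolℚ (L ⊆ᵇ K))) ⟩
      0ℚ + (∑[ K ← allVecs m ] d (false ∷ K) * boolℚ (L ⊆ᵇ K))
    ≡⟨ cong (_+ (∑[ K ← allVecs m ] d (false ∷ K) * boolℚ (L ⊆ᵇ K))) (sym (∑-zero (allVecs m) (λ K →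
         trans (cong (_* boolℚ (L ⊆ᵇ K)) (true-headed K)) (ℚ.*-zeroˡ (boolℚ (L ⊆ᵇ K)))))) ⟩
      (∑[ K ← allVecs m ] d (true ∷ K) * boolℚ (L ⊆ᵇ K)) + (∑[ K ← allVecs m ] d (false ∷ K) * boolℚ (L ⊆ᵇ K))
    ≡⟨ sym (∑-allVecs-suc m _) ⟩
      ∑[ K ← allVecs (suc m) ] d K * boolℚ ((false ∷ L) ⊆ᵇ K)
    ≡⟨ zeta≡0 (false ∷ L) ⟩
      0ℚ
    ∎
  by-head : ∀ K → d K ≡ 0ℚ
  by-head (true ∷ K)  = true-headed K
  by-head (false ∷ K) = false-headed K

-- Permutation words and peak sets

occursᵇ : {n k : ℕ} → Fin n → Vec (Fin n) k → Bool
occursᵇ i = Vec.foldr _ (λ j b → (toℕ i ≡ᵇ toℕ j) ∨ b) false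

Covers : {n k : ℕ} → Vec (Fin n) k → Set
Covers {n} v = (i : Fin n) → T (occursᵇ i v)

allᵇ : {N n : ℕ} → (Fin N → Bool) → Vec (Fin N) n → Bool
allᵇ P = Vec.foldr _ (λ i acc → P i ∧ acc) true

T-allᵇ-tabulate : {N n : ℕ} (P : Fin N → Bool) (f : Fin n → Fin N) → T (allᵇ P (Vec.tabulate f)) ⇔ (∀ i → T (P (f i)))
T-allᵇ-tabulate {n = zero}  P f = mk⇔ (λ _ ()) (λ _ → tt)
T-allᵇ-tabulate {n = suc n} P f = mk⇔ to from
  where
  IH : T (allᵇ P (Vec.tabulate (f ∘ Fin.suc))) ⇔ (∀ i → T (P (f (Fin.suc i))))
  IH = T-allᵇ-tabulate P (f ∘ Fin.suc)
  to : T (allᵇ P (Vec.tabulate f)) → ∀ i → T (P (f i))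
  to t Fin.zero    = proj₁ (Equivalence.to T-∧ t)
  to t (Fin.suc i) = Equivalence.to IH (proj₂ (Equivalence.to T-∧ t)) i
  from : (∀ i → T (P (f i))) → T (allᵇ P (Vec.tabulate f))
  from h = Equivalence.from T-∧ (h Fin.zero , Equivalence.from IH (h ∘ Fin.suc))

isPerm⇔Covers : {n : ℕ} (w : Vec (Fin n) n) → T (isPermᵇ w) ⇔ Covers w
isPerm⇔Covers w = T-allᵇ-tabulate (λ i → occursᵇ i w) id

occurs⇒∈ : {n k : ℕ} (i : Fin n) (v : Vec (Fin n) k) → T (occursᵇ i v) → i ∈ toList v
occurs⇒∈ i (j ∷ v) t with Equivalence.to T-∨ t
... | inj₁ i≡ᵇj = here (toℕ-injective (ℕ.≡ᵇ⇒≡ (toℕ i) (toℕ j) i≡ᵇj))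
... | inj₂ i∈v  = there (occurs⇒∈ i v i∈v)

covering-length : {n : ℕ} (xs : List (Fin n)) → (∀ i → i ∈ xs) → n ≤ length xs
covering-length xs cover = injective⇒≤ {f = λ i → index (cover i)} λ {i} {j} eq →
  trans (lookup-index (cover i)) (trans (cong (List.lookup xs) eq) (sym (lookup-index (cover j))))

-- If two neighbours coincided, deleting one of them would leave a covering list that is too short.
neighbours-distinct : {n k : ℕ} (pre : List (Fin n)) (v : Vec (Fin n) k) →
                      (∀ i → i ∈ pre ++ toList v) → length (pre ++ toList v) ≡ n → Linked _≢_ v
neighbours-distinct pre []          cover len = []
neighbours-distinct pre (x ∷ [])    cover len = [-]
neighbours-distinct pre (x ∷ y ∷ v) cover len =
  x≢y ∷ neighbours-distinct (pre ++ List.[ x ]) (y ∷ v) (subst (λ xs → ∀ i → i ∈ xs) reassociate cover)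
                                                      (trans (cong length (sym reassociate)) len)
  where
  reassociate : pre ++ x ∷ y ∷ toList v ≡ (pre ++ List.[ x ]) ++ y ∷ toList v
  reassociate = sym (++-assoc pre List.[ x ] _)
  x≢y : x ≢ y
  x≢y refl = ℕ.1+n≰n (subst (_≤ length (pre ++ x ∷ toList v)) (trans (sym len) (length-++-sucʳ pre x _))
                               (covering-length (pre ++ x ∷ toList v) deduplicated))
    where
    drop-duplicate : ∀ {i} → i ∈ x ∷ x ∷ toList v → i ∈ x ∷ toList v
    drop-duplicate (here i≡x) = here i≡x
    drop-duplicate (there i∈) = i∈
    deduplicated : ∀ i → i ∈ pre ++ x ∷ toList v
    deduplicated i = [ ∈-++⁺ˡ , ∈-++⁺ʳ pre ∘ drop-duplicate ] (∈-++⁻ pre (cover i))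

vals : {n : ℕ} → Perm n → Vec ℕ n
vals u = Vec.map toℕ (word u)

vals-neighbours-distinct : {n : ℕ} (u : Perm n) → Linked _≢_ (vals u)
vals-neighbours-distinct (perm w valid) =
  map⁺ (Linked.map (λ i≢j → i≢j ∘ toℕ-injective) (neighbours-distinct [] w cover (length-toList w)))
  where
  cover : ∀ i → i ∈ toList w
  cover i = occurs⇒∈ i w (Equivalence.to (isPerm⇔Covers w) valid i)

prependMin : {m : ℕ} → Perm m → Perm (suc m)
prependMin (perm w valid) = perm (Fin.zero ∷ Vec.map Fin.suc w) (Equivalence.from (isPerm⇔Covers (Fin.zero ∷ Vec.map Fin.suc w)) covers)
  where
  occurs-suc : ∀ {n k} (i : Fin n) (v : Vec (Fin n) k) → occursᵇ (Fin.suc i) (Vec.map Fin.suc v) ≡ occursᵇ i v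
  occurs-suc i []      = refl
  occurs-suc i (j ∷ v) = cong ((toℕ i ≡ᵇ toℕ j) ∨_) (occurs-suc i v)
  covers : Covers (Fin.zero ∷ Vec.map Fin.suc w)
  covers Fin.zero    = tt
  covers (Fin.suc i) = subst T (sym (occurs-suc i w)) (Equivalence.to (isPerm⇔Covers w) valid i)

swap12 : {m : ℕ} → Perm (suc (suc m)) → Perm (suc (suc m))
swap12 (perm (a ∷ b ∷ w) valid) = perm (b ∷ a ∷ w) (Equivalence.from (isPerm⇔Covers (b ∷ a ∷ w)) covers)
  where
  ∨-swap : ∀ x y z → x ∨ (y ∨ z) ≡ y ∨ (x ∨ z)
  ∨-swap x y z = trans (sym (∨-assoc x y z)) (trans (cong (_∨ z) (∨-comm x y)) (∨-assoc y x z))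
  covers : Covers (b ∷ a ∷ w)
  covers i = subst T (∨-swap (toℕ i ≡ᵇ toℕ a) (toℕ i ≡ᵇ toℕ b) (occursᵇ i w)) (Equivalence.to (isPerm⇔Covers (a ∷ b ∷ w)) valid i)

lift12 lift21 : {m : ℕ} → Perm m → Perm (suc (suc m))
lift12 v = prependMin (prependMin v)
lift21 v = swap12 (lift12 v)

identity : (m : ℕ) → Perm m
identity zero    = perm [] tt
identity (suc m) = prependMin (identity m)

vals-prependMin : {m : ℕ} (v : Perm m) → vals (prependMin v) ≡ 0 ∷ Vec.map suc (vals v)
vals-prependMin (perm w _) = cong (0 ∷_) (trans (sym (map-∘ toℕ Fin.suc w)) (map-∘ suc toℕ w))

vals-lift12 : {m : ℕ} (v : Perm m) → vals (lift12 v) ≡ 0 ∷ 1 ∷ Vec.map suc (Vec.map suc (vals v))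
vals-lift12 v = trans (vals-prependMin (prependMin v)) (cong (λ vs → 0 ∷ Vec.map suc vs) (vals-prependMin v))

vals-lift21 : {m : ℕ} (v : Perm m) → vals (lift21 v) ≡ 1 ∷ 0 ∷ Vec.map suc (Vec.map suc (vals v))
vals-lift21 v@(perm _ _) = cong (λ vs → 1 ∷ 0 ∷ Vec.tail (Vec.tail vs)) (vals-lift12 v)

vals-identity : (m : ℕ) → vals (identity m) ≡ Vec.iterate suc 0 m
vals-identity zero    = refl
vals-identity (suc m) = trans (vals-prependMin (identity m)) (cong (0 ∷_) (trans (cong (Vec.map suc) (vals-identity m)) (map-suc-iterate 0 m)))
  where
  map-suc-iterate : ∀ p k → Vec.map suc (Vec.iterate suc p k) ≡ Vec.iterate suc (suc p) k
  map-suc-iterate p zero    = refl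
  map-suc-iterate p (suc k) = cong (suc p ∷_) (map-suc-iterate (suc p) k)

<ᵇ-true : {m n : ℕ} → m < n → (m <ᵇ n) ≡ true
<ᵇ-true m<n = Equivalence.to T-≡ (ℕ.<⇒<ᵇ m<n)

<ᵇ-false : {m n : ℕ} → ¬ m < n → (m <ᵇ n) ≡ false
<ᵇ-false {m} {n} m≮n = ¬-not (m≮n ∘ ℕ.<ᵇ⇒< m n ∘ Equivalence.from T-≡)

infixr 5 _∷′_
_∷′_ : {k : ℕ} → Bool → Vec Bool (pred k) → Vec Bool k
_∷′_ {zero}  b v = []
_∷′_ {suc k} b v = b ∷ v

tail′ : {k : ℕ} → Vec Bool k → Vec Bool (pred k)
tail′ []      = []
tail′ (b ∷ v) = v

Peak-vals : {n : ℕ} (u : Perm n) → Peak u ≡ peaksFrom 0 (Vec.map suc (vals u))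
Peak-vals u = cong (peaksFrom 0) (map-∘ suc toℕ (word u))

peaksFrom-shift : {k : ℕ} (p : ℕ) (xs : Vec ℕ k) → peaksFrom (suc p) (Vec.map suc xs) ≡ peaksFrom p xs
peaksFrom-shift p []           = refl
peaksFrom-shift p (x ∷ [])     = refl
peaksFrom-shift p (x ∷ y ∷ xs) = cong (_ ∷_) (peaksFrom-shift x (y ∷ xs))

peaksFrom-base : {k : ℕ} (p q x : ℕ) (xs : Vec ℕ k) → (p <ᵇ x) ≡ (q <ᵇ x) → peaksFrom p (x ∷ xs) ≡ peaksFrom q (x ∷ xs)
peaksFrom-base p q x []       eq = refl
peaksFrom-base p q x (y ∷ xs) eq = cong (λ b → (b ∧ (y <ᵇ x)) ∷ peaksFrom x (y ∷ xs)) eq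

Peak-prependMin : {m : ℕ} (v : Perm m) → Peak (prependMin v) ≡ false ∷′ Peak v
Peak-prependMin v = begin
    Peak (prependMin v)                                           ≡⟨ Peak-vals (prependMin v) ⟩
    peaksFrom 0 (Vec.map suc (vals (prependMin v)))                ≡⟨ cong (peaksFrom 0 ∘ Vec.map suc) (vals-prependMin v) ⟩
    peaksFrom 0 (1 ∷ Vec.map suc (Vec.map suc (vals v)))      ≡⟨ below (vals v) ⟩
    false ∷′ peaksFrom 0 (Vec.map suc (vals v))               ≡⟨ cong (false ∷′_) (sym (Peak-vals v)) ⟩
    false ∷′ Peak v                                           ∎
  where
  below : ∀ {k} (zs : Vec ℕ k) → peaksFrom 0 (1 ∷ Vec.map suc (Vec.map suc zs)) ≡ false ∷′ peaksFrom 0 (Vec.map suc zs)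
  below []       = refl
  below (z ∷ zs) = cong (false ∷_) (peaksFrom-shift 0 (Vec.map suc (z ∷ zs)))

Peak-lift12 : {m : ℕ} (v : Perm m) → Peak (lift12 v) ≡ false ∷ (false ∷′ Peak v)
Peak-lift12 v = trans (Peak-prependMin (prependMin v)) (cong (false ∷_) (Peak-prependMin v))

Peak-lift21 : {m : ℕ} (v : Perm m) → Peak (lift21 v) ≡ true ∷ (false ∷′ Peak v)
Peak-lift21 v = begin
    Peak (lift21 v)                                                       ≡⟨ Peak-vals (lift21 v) ⟩
    peaksFrom 0 (Vec.map suc (vals (lift21 v)))                            ≡⟨ cong (peaksFrom 0 ∘ Vec.map suc) (vals-lift21 v) ⟩
    peaksFrom 0 (2 ∷ 1 ∷ Vec.map suc (Vec.map suc (Vec.map suc (vals v)))) ≡⟨ below (vals v) ⟩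
    true ∷ (false ∷′ peaksFrom 0 (Vec.map suc (vals v)))                   ≡⟨ cong (λ P → true ∷ (false ∷′ P)) (sym (Peak-vals v)) ⟩
    true ∷ (false ∷′ Peak v)                                               ∎
  where
  below : ∀ {k} (zs : Vec ℕ k) →
          peaksFrom 0 (2 ∷ 1 ∷ Vec.map suc (Vec.map suc (Vec.map suc zs))) ≡ true ∷ (false ∷′ peaksFrom 0 (Vec.map suc zs))
  below []       = refl
  below (z ∷ zs) = cong (λ P → true ∷ false ∷ P) (begin
      peaksFrom 1 (Vec.map suc (Vec.map suc (Vec.map suc (z ∷ zs)))) ≡⟨ peaksFrom-shift 0 _ ⟩
      peaksFrom 0 (Vec.map suc (Vec.map suc (z ∷ zs)))                ≡⟨ peaksFrom-base 0 1 _ _ refl ⟩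
      peaksFrom 1 (Vec.map suc (Vec.map suc (z ∷ zs)))                ≡⟨ peaksFrom-shift 0 _ ⟩
      peaksFrom 0 (Vec.map suc (z ∷ zs))                              ∎)

peaksFrom-noConsec : {k : ℕ} (p : ℕ) (xs : Vec ℕ k) → T (noConsec (peaksFrom p xs))
peaksFrom-noConsec p []               = tt
peaksFrom-noConsec p (x ∷ [])         = tt
peaksFrom-noConsec p (x ∷ y ∷ [])     = tt
peaksFrom-noConsec p (x ∷ y ∷ z ∷ xs) =
  Equivalence.from T-∧ (not-both (p <ᵇ x) (y <ᵇ x) (x <ᵇ y) (z <ᵇ y) asym , peaksFrom-noConsec x (y ∷ z ∷ xs))
  where
  asym : T (y <ᵇ x) → (x <ᵇ y) ≡ false
  asym y<x = <ᵇ-false (ℕ.<-asym (ℕ.<ᵇ⇒< y x y<x))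
  not-both : ∀ a b c d → (T b → c ≡ false) → T (not ((a ∧ b) ∧ (c ∧ d)))
  not-both false b     c d _ = tt
  not-both true  false c d _ = tt
  not-both true  true  c d h rewrite h tt = tt

Peak-noConsec : {n : ℕ} (u : Perm n) → T (noConsec (Peak u))
Peak-noConsec u = peaksFrom-noConsec 0 (Vec.map (suc ∘ toℕ) (word u))

noConsec-tail : {k : ℕ} (a : Bool) (G : Vec Bool k) → T (noConsec (a ∷ G)) → T (noConsec G)
noConsec-tail a []      _  = tt
noConsec-tail a (b ∷ G) nc = proj₂ (Equivalence.to T-∧ nc)

tail-noConsec : {k : ℕ} (G : Vec Bool k) → T (noConsec G) → T (noConsec (tail′ G))
tail-noConsec []      _  = tt
tail-noConsec (a ∷ G) nc = noConsec-tail a G nc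

noConsec-after-true : {k : ℕ} (G : Vec Bool k) → T (noConsec (true ∷ G)) → G ≡ false ∷′ tail′ G
noConsec-after-true []          _ = refl
noConsec-after-true (false ∷ G) _ = refl

peak-realisable : (m : ℕ) (G : Vec Bool (pred m)) → T (noConsec G) → Σ (Perm m) (λ v → Peak v ≡ G)
peak-realisable zero          []          _  = identity 0 , refl
peak-realisable (suc zero)    []          _  = identity 1 , refl
peak-realisable (suc (suc k)) (false ∷ G) nc with peak-realisable (suc k) G (noConsec-tail false G nc)
... | v , refl = prependMin v , Peak-prependMin v
peak-realisable (suc (suc k)) (true ∷ G)  nc with peak-realisable k (tail′ G) (tail-noConsec G (noConsec-tail true G nc))
... | v , Peak-v = lift21 v , trans (Peak-lift21 v) (cong (true ∷_) (trans (cong (false ∷′_) Peak-v) (sym (noConsec-after-true G nc))))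

-- Signed entries and their descents

signed : Bool → ℕ → ℤ
signed s x = if s then -[1+ x ] else ℤ.+ suc x

not-≤ᵇ : ∀ m n → not (m ≤ᵇ n) ≡ (n <ᵇ m)
not-≤ᵇ zero          n       = refl
not-≤ᵇ (suc m)       zero    = refl
not-≤ᵇ (suc zero)    (suc n) = refl
not-≤ᵇ (suc (suc m)) (suc n) = not-≤ᵇ (suc m) n

signedGt : Bool → ℕ → Bool → ℕ → Bool
signedGt false x false y = y <ᵇ x
signedGt false x true  y = true
signedGt true  x false y = false
signedGt true  x true  y = x <ᵇ y

signed->ᵇ : ∀ s x t y → (signed s x >ᵇ signed t y) ≡ signedGt s x t y
signed->ᵇ false x false y = not-≤ᵇ (suc x) (suc y)
signed->ᵇ false x true  y = refl
signed->ᵇ true  x false y = refl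
signed->ᵇ true  x true  y = not-≤ᵇ y x

signedGt-< : ∀ s t {x y} → x < y → signedGt s x t y ≡ t
signedGt-< false false x<y = <ᵇ-false (ℕ.<-asym x<y)
signedGt-< false true  x<y = refl
signedGt-< true  false x<y = refl
signedGt-< true  true  x<y = <ᵇ-true x<y

signedGt-> : ∀ s t {x y} → y < x → signedGt s x t y ≡ not s
signedGt-> false false y<x = <ᵇ-true y<x
signedGt-> false true  y<x = refl
signedGt-> true  false y<x = refl
signedGt-> true  true  y<x = <ᵇ-false (ℕ.<-asym y<x)

descents : {k : ℕ} → Bool → ℕ → Vec Bool k → Vec ℕ k → Vec Bool k
descents t p []      []       = []
descents t p (s ∷ ε) (x ∷ xs) = signedGt t p s x ∷ descents s x ε xs

descentsFrom-signed : {k : ℕ} (t : Bool) (p : ℕ) (ε : Vec Bool k) (xs : Vec ℕ k) →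
                      descentsFrom (signed t p) (Vec.zipWith signed ε xs) ≡ descents t p ε xs
descentsFrom-signed t p []      []       = refl
descentsFrom-signed t p (s ∷ ε) (x ∷ xs) = cong₂ _∷_ (signed->ᵇ t p s x) (descentsFrom-signed s x ε xs)

descents-shift : {k : ℕ} (t : Bool) (p : ℕ) (ε : Vec Bool k) (xs : Vec ℕ k) →
                 descents t (suc p) ε (Vec.map suc xs) ≡ descents t p ε xs
descents-shift t p []      []       = refl
descents-shift t p (s ∷ ε) (x ∷ xs) = cong₂ _∷_ (shift t s) (descents-shift s x ε xs)
  where
  shift : ∀ t s → signedGt t (suc p) s (suc x) ≡ signedGt t p s x
  shift false false = refl
  shift false true  = refl
  shift true  false = refl
  shift true  true  = refl

entries-signed : {n : ℕ} (u : Perm n) (ε : Vec Bool n) → entries u ε ≡ Vec.zipWith signed ε (vals u)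
entries-signed u ε = go ε (word u)
  where
  go : ∀ {k n} (ε : Vec Bool k) (w : Vec (Fin n) k) →
       Vec.zipWith (λ s i → if s then -[1+ toℕ i ] else ℤ.+ suc (toℕ i)) ε w ≡ Vec.zipWith signed ε (Vec.map toℕ w)
  go []      []      = refl
  go (s ∷ ε) (i ∷ w) = cong (signed s (toℕ i) ∷_) (go ε w)

descentsFrom-zero : {k : ℕ} (s : Bool) (x : ℕ) (ε : Vec Bool k) (xs : Vec ℕ k) →
                    descentsFrom (ℤ.+ 0) (Vec.zipWith signed (s ∷ ε) (x ∷ xs)) ≡ s ∷ descents s x ε xs
descentsFrom-zero s x ε xs = cong₂ _∷_ (above-zero s) (descentsFrom-signed s x ε xs)
  where
  above-zero : ∀ s → ((ℤ.+ 0) >ᵇ signed s x) ≡ s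
  above-zero false = refl
  above-zero true  = refl

DesB-signed : {m : ℕ} (v : Perm m) (ε : Vec Bool m) → DesB (sperm v ε) ≡ descentsFrom (ℤ.+ 0) (Vec.zipWith signed ε (vals v))
DesB-signed v ε = cong (descentsFrom (ℤ.+ 0)) (entries-signed v ε)

DesB-identity : (m : ℕ) (L : Vec Bool m) → DesB (sperm (identity m) L) ≡ L
DesB-identity m L = trans (DesB-signed (identity m) L) (trans (cong (descentsFrom (ℤ.+ 0) ∘ Vec.zipWith signed L) (vals-identity m)) (rising L))
  where
  ascending : ∀ {k} t p (ε : Vec Bool k) → descents t p ε (Vec.iterate suc (suc p) k) ≡ ε
  ascending t p []      = refl
  ascending t p (s ∷ ε) = cong₂ _∷_ (signedGt-< t s (ℕ.n<1+n p)) (ascending s (suc p) ε)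
  rising : ∀ {k} (ε : Vec Bool k) → descentsFrom (ℤ.+ 0) (Vec.zipWith signed ε (Vec.iterate suc 0 k)) ≡ ε
  rising []      = refl
  rising (s ∷ ε) = trans (descentsFrom-zero s 0 ε _) (cong (s ∷_) (ascending s 0 ε))

desDvec-signed : {m : ℕ} (s₁ s₂ : Bool) (x₁ x₂ : ℕ) (ε : Vec Bool m) (xs : Vec ℕ m) →
                 desDvec (Vec.zipWith signed (s₁ ∷ s₂ ∷ ε) (x₁ ∷ x₂ ∷ xs))
                 ≡ signedGt (not s₁) x₁ s₂ x₂ ∷ signedGt s₁ x₁ s₂ x₂ ∷ descents s₂ x₂ ε xs
desDvec-signed s₁ s₂ x₁ x₂ ε xs =
  cong₂ _∷_ (trans (cong (_>ᵇ signed s₂ x₂) (neg-signed s₁)) (signed->ᵇ (not s₁) x₁ s₂ x₂))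
            (cong₂ _∷_ (signed->ᵇ s₁ x₁ s₂ x₂) (descentsFrom-signed s₂ x₂ ε xs))
  where
  neg-signed : ∀ s → ℤ.- signed s x₁ ≡ signed (not s) x₁
  neg-signed false = refl
  neg-signed true  = refl

-- Sign vectors of B-permutations

descentCount : {k : ℕ} → Bool → ℕ → Vec ℕ k → Vec Bool k → ℚ
descentCount {k} t p xs K = ∑[ ε ← allVecs k ] boolℚ (descents t p ε xs ⊆ᵇ K)

descentCount-∷ : {k : ℕ} (t : Bool) (p x : ℕ) (xs : Vec ℕ k) (b : Bool) (K : Vec Bool k) →
  descentCount t p (x ∷ xs) (b ∷ K)
  ≡ (if not (signedGt t p true x) ∨ b then descentCount true x xs K else 0ℚ)
    + (if not (signedGt t p false x) ∨ b then descentCount false x xs K else 0ℚ)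
descentCount-∷ {k} t p x xs b K =
  trans (∑-allVecs-suc k _) (cong₂ _+_ (∑-boolℚ-∧ (allVecs k) (not (signedGt t p true x) ∨ b) (λ ε → descents true x ε xs ⊆ᵇ K))
                                       (∑-boolℚ-∧ (allVecs k) (not (signedGt t p false x) ∨ b) (λ ε → descents false x ε xs ⊆ᵇ K)))

descentCount-rising : {k : ℕ} (t : Bool) {p x : ℕ} (xs : Vec ℕ k) (b : Bool) (K : Vec Bool k) → p < x →
  descentCount t p (x ∷ xs) (b ∷ K) ≡ (if b then descentCount true x xs K else 0ℚ) + descentCount false x xs K
descentCount-rising t {p} {x} xs b K p<x = trans (descentCount-∷ t p x xs b K)
  (cong₂ _+_ (cong (λ g → if not g ∨ b then descentCount true x xs K else 0ℚ) (signedGt-< t true p<x))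
             (cong (λ g → if not g ∨ b then descentCount false x xs K else 0ℚ) (signedGt-< t false p<x)))

descentCount-falling : {k : ℕ} (t : Bool) {p x : ℕ} (xs : Vec ℕ k) (b : Bool) (K : Vec Bool k) → x < p →
  descentCount t p (x ∷ xs) (b ∷ K)
  ≡ (if t ∨ b then descentCount true x xs K + descentCount false x xs K else 0ℚ)
descentCount-falling t {p} {x} xs b K x<p = trans (descentCount-∷ t p x xs b K)
  (trans (cong₂ _+_ (cong (λ g → if not g ∨ b then descentCount true x xs K else 0ℚ) (signedGt-> t true x<p))
                    (cong (λ g → if not g ∨ b then descentCount false x xs K else 0ℚ) (signedGt-> t false x<p)))
         (merge t b))
  where
  merge : ∀ t b → (if not (not t) ∨ b then descentCount true x xs K else 0ℚ)
                  + (if not (not t) ∨ b then descentCount false x xs K else 0ℚ)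
                  ≡ (if t ∨ b then descentCount true x xs K + descentCount false x xs K else 0ℚ)
  merge true  b     = refl
  merge false true  = refl
  merge false false = ℚ.+-identityˡ 0ℚ

-- G marks peaks at the positions of K; each must lie in K or right after a position in K,
-- b₀ standing for the position before the first.
peaksCovered : {k : ℕ} → Bool → Vec Bool k → Vec Bool k → Bool
peaksCovered b₀ []      []      = true
peaksCovered b₀ (b ∷ K) (g ∷ G) = (b₀ ∨ b ∨ not g) ∧ peaksCovered b K G

peaksCovered-nonpeak : {k : ℕ} (p x : ℕ) (xs : Vec ℕ k) (K : Vec Bool k) → (p <ᵇ x) ≡ false →
  peaksCovered true K (peaksFrom (suc p) (suc x ∷ Vec.map suc xs)) ≡ peaksCovered false K (peaksFrom (suc p) (suc x ∷ Vec.map suc xs))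
peaksCovered-nonpeak p x []       []      _   = refl
peaksCovered-nonpeak p x (y ∷ xs) (b ∷ K) p≮x rewrite p≮x | ∨-zeroʳ b = refl

two : ℚ
two = 1ℚ + 1ℚ

double : ∀ a b → (a + b) + (a + b) ≡ two * (b + a)
double = solve 2 (λ a b → (a :+ b) :+ (a :+ b) := (con 1ℚ :+ con 1ℚ) :* (b :+ a)) refl

double-zero : ∀ c → (0ℚ + c) + (0ℚ + c) ≡ two * c
double-zero = solve 1 (λ c → (con 0ℚ :+ c) :+ (con 0ℚ :+ c) := (con 1ℚ :+ con 1ℚ) :* c) refl

2^∣_∣ : {k : ℕ} → Vec Bool k → ℚ
2^∣ []        ∣ = 1ℚ
2^∣ true ∷ K  ∣ = two * 2^∣ K ∣
2^∣ false ∷ K ∣ = 2^∣ K ∣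

mutual
  descentCount-positive : {k : ℕ} (q p : ℕ) (xs : Vec ℕ k) (K : Vec Bool k) → q ≤ p → Linked _≢_ (p ∷ xs) →
    descentCount false p xs K ≡ 2^∣ K ∣ * boolℚ (peaksCovered false K (peaksFrom q (suc p ∷ Vec.map suc xs)))
  descentCount-positive         q p []       []      q≤p _                = refl
  descentCount-positive {suc k} q p (x ∷ xs) (b ∷ K) q≤p (p≢x ∷ linked) = by-order (ℕ.<-cmp p x) b
    where
    G : Vec Bool k
    G = peaksFrom (suc p) (suc x ∷ Vec.map suc xs)
    by-order : Tri (p < x) (p ≡ x) (x < p) → ∀ b →
      descentCount false p (x ∷ xs) (b ∷ K) ≡ 2^∣ b ∷ K ∣ * boolℚ (peaksCovered false (b ∷ K) (((q <ᵇ suc p) ∧ (x <ᵇ p)) ∷ G))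
    by-order (tri≈ _ p≡x _) _     = ⊥-elim (p≢x p≡x)
    by-order (tri< p<x _ _) true  = trans (descentCount-rising false xs true K p<x)
      (trans (ℚ.+-comm (descentCount true x xs K) _) (descentCount-both (suc p) x xs K linked))
    by-order (tri< p<x _ _) false rewrite <ᵇ-true (s≤s q≤p) | <ᵇ-false (ℕ.<-asym p<x) = trans (descentCount-rising false xs false K p<x)
      (trans (ℚ.+-identityˡ (descentCount false x xs K)) (descentCount-positive (suc p) x xs K p<x linked))
    by-order (tri> _ _ x<p) true  = trans (descentCount-falling false xs true K x<p)
      (trans (ℚ.+-comm (descentCount true x xs K) _) (descentCount-both (suc p) x xs K linked))
    by-order (tri> _ _ x<p) false rewrite <ᵇ-true (s≤s q≤p) | <ᵇ-true x<p =
      trans (descentCount-falling false xs false K x<p) (sym (ℚ.*-zeroʳ 2^∣ K ∣))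

  descentCount-both : {k : ℕ} (q p : ℕ) (xs : Vec ℕ k) (K : Vec Bool k) → Linked _≢_ (p ∷ xs) →
    descentCount false p xs K + descentCount true p xs K
    ≡ two * 2^∣ K ∣ * boolℚ (peaksCovered true K (peaksFrom q (suc p ∷ Vec.map suc xs)))
  descentCount-both         q p []       []      _              = refl
  descentCount-both {suc k} q p (x ∷ xs) (b ∷ K) (p≢x ∷ linked) = by-order (ℕ.<-cmp p x) b
    where
    G : Vec Bool k
    G = peaksFrom (suc p) (suc x ∷ Vec.map suc xs)
    C : Bool → ℚ
    C s = descentCount s x xs K
    both : ∀ b → descentCount false p (x ∷ xs) (b ∷ K) + descentCount true p (x ∷ xs) (b ∷ K) ≡ (C true + C false) + (C true + C false) →
           descentCount false p (x ∷ xs) (b ∷ K) + descentCount true p (x ∷ xs) (b ∷ K) ≡ two * (two * 2^∣ K ∣) * boolℚ (peaksCovered true K G)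
    both b doubled = begin
      descentCount false p (x ∷ xs) (b ∷ K) + descentCount true p (x ∷ xs) (b ∷ K) ≡⟨ doubled ⟩
      (C true + C false) + (C true + C false)                                       ≡⟨ double (C true) (C false) ⟩
      two * (C false + C true)                                                      ≡⟨ cong (two *_) (descentCount-both (suc p) x xs K linked) ⟩
      two * (two * 2^∣ K ∣ * boolℚ (peaksCovered true K G))                         ≡⟨ sym (ℚ.*-assoc two (two * 2^∣ K ∣) _) ⟩
      two * (two * 2^∣ K ∣) * boolℚ (peaksCovered true K G)                         ∎
    by-order : Tri (p < x) (p ≡ x) (x < p) → ∀ b →
      descentCount false p (x ∷ xs) (b ∷ K) + descentCount true p (x ∷ xs) (b ∷ K) ≡ two * 2^∣ b ∷ K ∣ * boolℚ (peaksCovered b K G)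
    by-order (tri≈ _ p≡x _) _     = ⊥-elim (p≢x p≡x)
    by-order (tri< p<x _ _) true  = both true (cong₂ _+_ (descentCount-rising false xs true K p<x) (descentCount-rising true xs true K p<x))
    by-order (tri> _ _ x<p) true  = both true (cong₂ _+_ (descentCount-falling false xs true K x<p) (descentCount-falling true xs true K x<p))
    by-order (tri< p<x _ _) false = begin
      descentCount false p (x ∷ xs) (false ∷ K) + descentCount true p (x ∷ xs) (false ∷ K)
        ≡⟨ cong₂ _+_ (descentCount-rising false xs false K p<x) (descentCount-rising true xs false K p<x) ⟩
      (0ℚ + C false) + (0ℚ + C false)                      ≡⟨ double-zero (C false) ⟩
      two * C false                                        ≡⟨ cong (two *_) (descentCount-positive (suc p) x xs K p<x linked) ⟩
      two * (2^∣ K ∣ * boolℚ (peaksCovered false K G))    ≡⟨ sym (ℚ.*-assoc two 2^∣ K ∣ _) ⟩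
      two * 2^∣ K ∣ * boolℚ (peaksCovered false K G)      ∎
    by-order (tri> _ _ x<p) false = begin
      descentCount false p (x ∷ xs) (false ∷ K) + descentCount true p (x ∷ xs) (false ∷ K)
        ≡⟨ cong₂ _+_ (descentCount-falling false xs false K x<p) (descentCount-falling true xs false K x<p) ⟩
      0ℚ + (C true + C false)                              ≡⟨ trans (ℚ.+-identityˡ _) (ℚ.+-comm (C true) (C false)) ⟩
      C false + C true                                     ≡⟨ descentCount-both (suc p) x xs K linked ⟩
      two * 2^∣ K ∣ * boolℚ (peaksCovered true K G)
        ≡⟨ cong (λ c → two * 2^∣ K ∣ * boolℚ c) (peaksCovered-nonpeak p x xs K (<ᵇ-false (ℕ.<-asym x<p))) ⟩
      two * 2^∣ K ∣ * boolℚ (peaksCovered false K G)      ∎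

coveredᴮ : {m : ℕ} → Vec Bool m → Vec Bool (pred m) → Bool
coveredᴮ []      P = true
coveredᴮ (b ∷ K) P = peaksCovered b K P

φ-X : {m : ℕ} (K : Vec Bool m) (v : Perm m) → φ (XB K) v ≡ 2^∣ K ∣ * boolℚ (coveredᴮ K (Peak v))
φ-X []               (perm [] _)          = refl
φ-X {suc m} (b ∷ K) v@(perm (i ∷ w) _) = begin
    ∑[ ε ← allVecs (suc m) ] XB (b ∷ K) (sperm v ε)
  ≡⟨ ∑-cong (allVecs (suc m)) (λ ε → trans (XB-apply (b ∷ K) (sperm v ε)) (cong (λ D → boolℚ (D ⊆ᵇ (b ∷ K))) (DesB-signed v ε))) ⟩
    ∑[ ε ← allVecs (suc m) ] boolℚ (descentsFrom (ℤ.+ 0) (Vec.zipWith signed ε (x ∷ xs)) ⊆ᵇ (b ∷ K))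
  ≡⟨ ∑-allVecs-suc m _ ⟩
    (∑[ ε ← allVecs m ] boolℚ (descentsFrom (ℤ.+ 0) (Vec.zipWith signed (true ∷ ε) (x ∷ xs)) ⊆ᵇ (b ∷ K)))
      + (∑[ ε ← allVecs m ] boolℚ (descentsFrom (ℤ.+ 0) (Vec.zipWith signed (false ∷ ε) (x ∷ xs)) ⊆ᵇ (b ∷ K)))
  ≡⟨ cong₂ _+_ (trans (∑-cong (allVecs m) (λ ε → cong (λ D → boolℚ (D ⊆ᵇ (b ∷ K))) (descentsFrom-zero true x ε xs)))
                      (∑-boolℚ-∧ (allVecs m) b (λ ε → descents true x ε xs ⊆ᵇ K)))
               (∑-cong (allVecs m) (λ ε → cong (λ D → boolℚ (D ⊆ᵇ (b ∷ K))) (descentsFrom-zero false x ε xs))) ⟩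
    (if b then descentCount true x xs K else 0ℚ) + descentCount false x xs K
  ≡⟨ from-below b ⟩
    2^∣ b ∷ K ∣ * boolℚ (peaksCovered b K (peaksFrom 0 (suc x ∷ Vec.map suc xs)))
  ≡⟨ cong (λ P → 2^∣ b ∷ K ∣ * boolℚ (peaksCovered b K P)) (sym (Peak-vals v)) ⟩
    2^∣ b ∷ K ∣ * boolℚ (coveredᴮ (b ∷ K) (Peak v))
  ∎
  where
  x : ℕ
  x = toℕ i
  xs : Vec ℕ m
  xs = Vec.map toℕ w
  linked : Linked _≢_ (x ∷ xs)
  linked = vals-neighbours-distinct v
  from-below : ∀ b → (if b then descentCount true x xs K else 0ℚ) + descentCount false x xs K
                     ≡ 2^∣ b ∷ K ∣ * boolℚ (peaksCovered b K (peaksFrom 0 (suc x ∷ Vec.map suc xs)))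
  from-below true  = trans (ℚ.+-comm (descentCount true x xs K) _) (descentCount-both 0 x xs K linked)
  from-below false = trans (ℚ.+-identityˡ _) (descentCount-positive 0 x xs K z≤n linked)

-- Sign vectors of D-permutations

evenᵛ : {k : ℕ} → Vec Bool k → Bool
evenᵛ ε = evenᵇ (countTrue ε)

sign : {k : ℕ} → Vec Bool k → ℚ
sign []          = 1ℚ
sign (false ∷ ε) = sign ε
sign (true ∷ ε)  = - sign ε

signedCount : {k : ℕ} → Bool → ℕ → Vec ℕ k → Vec Bool k → ℚ
signedCount {k} t p xs K = ∑[ ε ← allVecs k ] sign ε * boolℚ (descents t p ε xs ⊆ᵇ K)

signedCount-∷ : {k : ℕ} (t : Bool) (p x : ℕ) (xs : Vec ℕ k) (b : Bool) (K : Vec Bool k) →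
  signedCount t p (x ∷ xs) (b ∷ K)
  ≡ (if not (signedGt t p false x) ∨ b then signedCount false x xs K else 0ℚ)
    - (if not (signedGt t p true x) ∨ b then signedCount true x xs K else 0ℚ)
signedCount-∷ {k} t p x xs b K = begin
    signedCount t p (x ∷ xs) (b ∷ K)
  ≡⟨ ∑-allVecs-suc k _ ⟩
    (∑[ ε ← allVecs k ] - sign ε * boolℚ (allowed true ∧ (descents true x ε xs ⊆ᵇ K)))
      + (∑[ ε ← allVecs k ] sign ε * boolℚ (allowed false ∧ (descents false x ε xs ⊆ᵇ K)))
  ≡⟨ cong (_+ (∑[ ε ← allVecs k ] sign ε * boolℚ (allowed false ∧ (descents false x ε xs ⊆ᵇ K))))
          (trans (∑-cong (allVecs k) (λ ε → sym (ℚ.neg-distribˡ-* (sign ε) _))) (∑-neg (allVecs k) _)) ⟩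
    - (∑[ ε ← allVecs k ] sign ε * boolℚ (allowed true ∧ (descents true x ε xs ⊆ᵇ K)))
      + (∑[ ε ← allVecs k ] sign ε * boolℚ (allowed false ∧ (descents false x ε xs ⊆ᵇ K)))
  ≡⟨ cong₂ (λ T F → - T + F) (∑-weighted-∧ (allVecs k) sign (allowed true) (λ ε → descents true x ε xs ⊆ᵇ K))
                              (∑-weighted-∧ (allVecs k) sign (allowed false) (λ ε → descents false x ε xs ⊆ᵇ K)) ⟩
    - (if allowed true then signedCount true x xs K else 0ℚ) + (if allowed false then signedCount false x xs K else 0ℚ)
  ≡⟨ ℚ.+-comm (- (if allowed true then signedCount true x xs K else 0ℚ)) _ ⟩
    (if allowed false then signedCount false x xs K else 0ℚ) - (if allowed true then signedCount true x xs K else 0ℚ)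
  ∎
  where
  allowed : Bool → Bool
  allowed s = not (signedGt t p s x) ∨ b

signedCount-sign-irrelevant : {k : ℕ} (p : ℕ) (xs : Vec ℕ k) (K : Vec Bool k) → Linked _≢_ (p ∷ xs) →
                              signedCount false p xs K ≡ signedCount true p xs K
signedCount-sign-irrelevant p []       []      _ = refl
signedCount-sign-irrelevant p (x ∷ xs) (b ∷ K) (p≢x ∷ linked) =
  trans (signedCount-∷ false p x xs b K) (trans (by-order (ℕ.<-cmp p x)) (sym (signedCount-∷ true p x xs b K)))
  where
  step : Bool → ℚ
  step t = (if not (signedGt t p false x) ∨ b then signedCount false x xs K else 0ℚ)
           - (if not (signedGt t p true x) ∨ b then signedCount true x xs K else 0ℚ)
  by-order : Tri (p < x) (p ≡ x) (x < p) → step false ≡ step true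
  by-order (tri< p<x _ _)
    rewrite signedGt-< false false p<x | signedGt-< false true p<x | signedGt-< true false p<x | signedGt-< true true p<x = refl
  by-order (tri≈ _ p≡x _) = ⊥-elim (p≢x p≡x)
  by-order (tri> _ _ x<p)
    rewrite signedGt-> false false x<p | signedGt-> false true x<p | signedGt-> true false x<p | signedGt-> true true x<p
          | signedCount-sign-irrelevant x xs K linked =
    trans (ℚ.+-inverseʳ (if b then signedCount true x xs K else 0ℚ)) (sym (ℚ.+-inverseʳ (signedCount true x xs K)))

boolℚ-not : ∀ b → boolℚ (not b) ≡ 1ℚ - boolℚ b
boolℚ-not true  = refl
boolℚ-not false = refl

boolℚ-even : {k : ℕ} (ε : Vec Bool k) → boolℚ (evenᵛ ε) ≡ ½ * (1ℚ + sign ε)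
boolℚ-even []          = refl
boolℚ-even (false ∷ ε) = boolℚ-even ε
boolℚ-even (true ∷ ε)  = trans (boolℚ-not (evenᵛ ε)) (trans (cong (λ e → 1ℚ - e) (boolℚ-even ε))
  (solve 1 (λ s → con 1ℚ :- con ½ :* (con 1ℚ :+ s) := con ½ :* (con 1ℚ :+ (:- s))) refl (sign ε)))

∑-even-half : (k : ℕ) (g : Vec Bool k → ℚ) → ∑[ ε ← allVecs k ] sign ε * g ε ≡ 0ℚ →
              ∑[ ε ← allVecs k ] boolℚ (evenᵛ ε) * g ε ≡ ½ * ∑ (allVecs k) g
∑-even-half k g signed≡0 = begin
    ∑[ ε ← allVecs k ] boolℚ (evenᵛ ε) * g ε
  ≡⟨ ∑-cong (allVecs k) (λ ε → trans (cong (_* g ε) (boolℚ-even ε))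
       (solve 2 (λ s g → con ½ :* (con 1ℚ :+ s) :* g := con ½ :* (g :+ s :* g)) refl (sign ε) (g ε))) ⟩
    ∑[ ε ← allVecs k ] ½ * (g ε + sign ε * g ε)
  ≡⟨ trans (∑-*ˡ (allVecs k) ½ _) (cong (½ *_) (∑-+ (allVecs k) g _)) ⟩
    ½ * (∑ (allVecs k) g + (∑[ ε ← allVecs k ] sign ε * g ε))
  ≡⟨ cong (λ s → ½ * (∑ (allVecs k) g + s)) signed≡0 ⟩
    ½ * (∑ (allVecs k) g + 0ℚ)
  ≡⟨ cong (½ *_) (ℚ.+-identityʳ (∑ (allVecs k) g)) ⟩
    ½ * ∑ (allVecs k) g
  ∎

∑-odd-half : (k : ℕ) (g : Vec Bool k → ℚ) → ∑[ ε ← allVecs k ] sign ε * g ε ≡ 0ℚ →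
             ∑[ ε ← allVecs k ] boolℚ (not (evenᵛ ε)) * g ε ≡ ½ * ∑ (allVecs k) g
∑-odd-half k g signed≡0 = begin
    ∑[ ε ← allVecs k ] boolℚ (not (evenᵛ ε)) * g ε
  ≡⟨ ∑-cong (allVecs k) (λ ε → trans (cong (_* g ε) (boolℚ-not (evenᵛ ε)))
       (solve 2 (λ e g → (con 1ℚ :- e) :* g := g :- e :* g) refl (boolℚ (evenᵛ ε)) (g ε))) ⟩
    ∑[ ε ← allVecs k ] (g ε - boolℚ (evenᵛ ε) * g ε)
  ≡⟨ ∑-- (allVecs k) g _ ⟩
    ∑ (allVecs k) g - (∑[ ε ← allVecs k ] boolℚ (evenᵛ ε) * g ε)
  ≡⟨ cong (λ e → ∑ (allVecs k) g - e) (∑-even-half k g signed≡0) ⟩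
    ∑ (allVecs k) g - ½ * ∑ (allVecs k) g
  ≡⟨ solve 1 (λ s → s :- con ½ :* s := con ½ :* s) refl (∑ (allVecs k) g) ⟩
    ½ * ∑ (allVecs k) g
  ∎

tailDescents : {k : ℕ} → ℕ → Vec ℕ k → Vec Bool (suc k) → Vec Bool k
tailDescents x xs (t ∷ ε) = descents t x ε xs

∑-sign-tailDescents : {k : ℕ} (x : ℕ) (xs : Vec ℕ k) (K : Vec Bool k) → Linked _≢_ (x ∷ xs) →
                      ∑[ ε ← allVecs (suc k) ] sign ε * boolℚ (tailDescents x xs ε ⊆ᵇ K) ≡ 0ℚ
∑-sign-tailDescents {k} x xs K linked = begin
    ∑[ ε ← allVecs (suc k) ] sign ε * boolℚ (tailDescents x xs ε ⊆ᵇ K)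
  ≡⟨ ∑-allVecs-suc k _ ⟩
    (∑[ ε ← allVecs k ] - sign ε * boolℚ (descents true x ε xs ⊆ᵇ K)) + signedCount false x xs K
  ≡⟨ cong (_+ signedCount false x xs K) (trans (∑-cong (allVecs k) (λ ε → sym (ℚ.neg-distribˡ-* (sign ε) _))) (∑-neg (allVecs k) _)) ⟩
    - signedCount true x xs K + signedCount false x xs K
  ≡⟨ cong (- signedCount true x xs K +_) (signedCount-sign-irrelevant x xs K linked) ⟩
    - signedCount true x xs K + signedCount true x xs K
  ≡⟨ ℚ.+-inverseˡ (signedCount true x xs K) ⟩
    0ℚ
  ∎

ψ-XD-sum : {n : ℕ} (J : Vec Bool n) (u : Perm n) →
          ψ (XD J) u ≡ ∑[ ε ← allVecs n ] boolℚ (evenᵛ ε) * boolℚ (desDvec (Vec.zipWith signed ε (vals u)) ⊆ᵇ J)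
ψ-XD-sum {n} J u = ∑-cong (allVecs n) (λ ε → term ε (T? (evenᵛ ε)))
  where
  term : ∀ ε (d : Dec (T (evenᵛ ε))) →
         evenTerm (XD J) u ε d ≡ boolℚ (evenᵛ ε) * boolℚ (desDvec (Vec.zipWith signed ε (vals u)) ⊆ᵇ J)
  term ε (yes even) = trans (XD-apply J (dperm u ε even)) (trans (sym (ℚ.*-identityˡ _))
    (cong₂ (λ e D → boolℚ e * boolℚ (desDvec D ⊆ᵇ J)) (sym (Equivalence.to T-≡ even)) (entries-signed u ε)))
  term ε (no odd) = trans (sym (ℚ.*-zeroˡ (boolℚ (desDvec (Vec.zipWith signed ε (vals u)) ⊆ᵇ J))))
    (cong (λ e → boolℚ e * boolℚ (desDvec (Vec.zipWith signed ε (vals u)) ⊆ᵇ J)) (sym (¬-not (odd ∘ Equivalence.from T-≡))))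

-- If |w₁| < |w₂| the sign of w₁ is irrelevant, and summing it out removes the parity condition; if |w₁| > |w₂|
-- it decides which of 1', 1 is a descent, and the parity condition halves the count as the signed count vanishes.
module _ {m : ℕ} (x₁ x₂ : ℕ) (ys : Vec ℕ m) (a b : Bool) (K : Vec Bool m) where

  ψ-sum : ℚ
  ψ-sum = ∑[ ε ← allVecs (suc (suc m)) ] boolℚ (evenᵛ ε)
                                         * boolℚ (desDvec (Vec.zipWith signed ε (x₁ ∷ x₂ ∷ ys)) ⊆ᵇ (a ∷ b ∷ K))

  admissible : Bool → Vec Bool (suc m) → Bool
  admissible t₁ ε = desDvec (Vec.zipWith signed (t₁ ∷ ε) (x₁ ∷ x₂ ∷ ys)) ⊆ᵇ (a ∷ b ∷ K)

  admissible-heads : ∀ t₁ t₂ ε {g₁ g₂} → signedGt (not t₁) x₁ t₂ x₂ ≡ g₁ → signedGt t₁ x₁ t₂ x₂ ≡ g₂ →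
                     admissible t₁ (t₂ ∷ ε) ≡ ((g₁ ∷ g₂ ∷ descents t₂ x₂ ε ys) ⊆ᵇ (a ∷ b ∷ K))
  admissible-heads t₁ t₂ ε e₁ e₂ = trans (cong (_⊆ᵇ (a ∷ b ∷ K)) (desDvec-signed t₁ t₂ x₁ x₂ ε ys))
    (cong₂ (λ g₁ g₂ → (g₁ ∷ g₂ ∷ descents t₂ x₂ ε ys) ⊆ᵇ (a ∷ b ∷ K)) e₁ e₂)

  ψ-sum-rising : x₁ < x₂ →
    ψ-sum ≡ (if a then (if b then descentCount true x₂ ys K else 0ℚ) else 0ℚ) + descentCount false x₂ ys K
  ψ-sum-rising x₁<x₂ = begin
      ψ-sum
    ≡⟨ ∑-allVecs-suc (suc m) _ ⟩
      (∑[ ε ← allVecs (suc m) ] boolℚ (not (evenᵛ ε)) * boolℚ (admissible true ε))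
        + (∑[ ε ← allVecs (suc m) ] boolℚ (evenᵛ ε) * boolℚ (admissible false ε))
    ≡⟨ cong₂ _+_ (∑-cong (allVecs (suc m)) (λ ε → cong (λ c → boolℚ (not (evenᵛ ε)) * boolℚ c) (first-sign-irrelevant true ε)))
                 (∑-cong (allVecs (suc m)) (λ ε → cong (λ c → boolℚ (evenᵛ ε) * boolℚ c) (first-sign-irrelevant false ε))) ⟩
      (∑[ ε ← allVecs (suc m) ] boolℚ (not (evenᵛ ε)) * boolℚ (rest ε))
        + (∑[ ε ← allVecs (suc m) ] boolℚ (evenᵛ ε) * boolℚ (rest ε))
    ≡⟨ trans (sym (∑-+ (allVecs (suc m)) _ _)) (∑-cong (allVecs (suc m)) (λ ε → parities (evenᵛ ε) (boolℚ (rest ε)))) ⟩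
      ∑[ ε ← allVecs (suc m) ] boolℚ (rest ε)
    ≡⟨ ∑-allVecs-suc m _ ⟩
      (∑[ ε ← allVecs m ] boolℚ (a ∧ (b ∧ (descents true x₂ ε ys ⊆ᵇ K)))) + descentCount false x₂ ys K
    ≡⟨ cong (_+ descentCount false x₂ ys K) (trans (∑-boolℚ-∧ (allVecs m) a _)
         (cong (λ s → if a then s else 0ℚ) (∑-boolℚ-∧ (allVecs m) b (λ ε → descents true x₂ ε ys ⊆ᵇ K)))) ⟩
      (if a then (if b then descentCount true x₂ ys K else 0ℚ) else 0ℚ) + descentCount false x₂ ys K
    ∎
    where
    rest : Vec Bool (suc m) → Bool
    rest (t₂ ∷ ε) = (not t₂ ∨ a) ∧ ((not t₂ ∨ b) ∧ (descents t₂ x₂ ε ys ⊆ᵇ K))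
    first-sign-irrelevant : ∀ t₁ ε → admissible t₁ ε ≡ rest ε
    first-sign-irrelevant t₁ (t₂ ∷ ε) = admissible-heads t₁ t₂ ε (signedGt-< (not t₁) t₂ x₁<x₂) (signedGt-< t₁ t₂ x₁<x₂)
    parities : ∀ e q → boolℚ (not e) * q + boolℚ e * q ≡ q
    parities true  q = trans (cong (_+ 1ℚ * q) (ℚ.*-zeroˡ q)) (trans (ℚ.+-identityˡ _) (ℚ.*-identityˡ q))
    parities false q = trans (cong (1ℚ * q +_) (ℚ.*-zeroˡ q)) (trans (ℚ.+-identityʳ _) (ℚ.*-identityˡ q))

  ψ-sum-falling : x₂ < x₁ → Linked _≢_ (x₂ ∷ ys) →
    ψ-sum ≡ (if a then ½ * (descentCount true x₂ ys K + descentCount false x₂ ys K) else 0ℚ)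
            + (if b then ½ * (descentCount true x₂ ys K + descentCount false x₂ ys K) else 0ℚ)
  ψ-sum-falling x₂<x₁ linked = begin
      ψ-sum
    ≡⟨ ∑-allVecs-suc (suc m) _ ⟩
      (∑[ ε ← allVecs (suc m) ] boolℚ (not (evenᵛ ε)) * boolℚ (admissible true ε))
        + (∑[ ε ← allVecs (suc m) ] boolℚ (evenᵛ ε) * boolℚ (admissible false ε))
    ≡⟨ cong₂ _+_ (∑-cong (allVecs (suc m)) (λ ε → cong (λ c → boolℚ (not (evenᵛ ε)) * boolℚ c) (first-sign-decides true ε)))
                 (∑-cong (allVecs (suc m)) (λ ε → cong (λ c → boolℚ (evenᵛ ε) * boolℚ c) (first-sign-decides false ε))) ⟩
      (∑[ ε ← allVecs (suc m) ] boolℚ (not (evenᵛ ε)) * boolℚ (a ∧ rest ε))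
        + (∑[ ε ← allVecs (suc m) ] boolℚ (evenᵛ ε) * boolℚ (b ∧ rest ε))
    ≡⟨ cong₂ _+_ (∑-weighted-∧ (allVecs (suc m)) (boolℚ ∘ not ∘ evenᵛ) a rest)
                 (∑-weighted-∧ (allVecs (suc m)) (boolℚ ∘ evenᵛ) b rest) ⟩
      (if a then ∑[ ε ← allVecs (suc m) ] boolℚ (not (evenᵛ ε)) * boolℚ (rest ε) else 0ℚ)
        + (if b then ∑[ ε ← allVecs (suc m) ] boolℚ (evenᵛ ε) * boolℚ (rest ε) else 0ℚ)
    ≡⟨ cong₂ _+_ (cong (λ s → if a then s else 0ℚ) (trans (∑-odd-half (suc m) (boolℚ ∘ rest) balanced) (cong (½ *_) total)))
                 (cong (λ s → if b then s else 0ℚ) (trans (∑-even-half (suc m) (boolℚ ∘ rest) balanced) (cong (½ *_) total))) ⟩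
      (if a then ½ * (descentCount true x₂ ys K + descentCount false x₂ ys K) else 0ℚ)
        + (if b then ½ * (descentCount true x₂ ys K + descentCount false x₂ ys K) else 0ℚ)
    ∎
    where
    rest : Vec Bool (suc m) → Bool
    rest ε = tailDescents x₂ ys ε ⊆ᵇ K
    first-sign-decides : ∀ t₁ ε → admissible t₁ ε ≡ ((if t₁ then a else b) ∧ rest ε)
    first-sign-decides true  (t₂ ∷ ε) = admissible-heads true  t₂ ε (signedGt-> false t₂ x₂<x₁) (signedGt-> true t₂ x₂<x₁)
    first-sign-decides false (t₂ ∷ ε) = admissible-heads false t₂ ε (signedGt-> true t₂ x₂<x₁) (signedGt-> false t₂ x₂<x₁)
    balanced : ∑[ ε ← allVecs (suc m) ] sign ε * boolℚ (rest ε) ≡ 0ℚ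
    balanced = ∑-sign-tailDescents x₂ ys K linked
    total : ∑ (allVecs (suc m)) (boolℚ ∘ rest) ≡ descentCount true x₂ ys K + descentCount false x₂ ys K
    total = ∑-allVecs-suc m (boolℚ ∘ rest)

ψValue : {m : ℕ} → Bool → Bool → Vec Bool m → Vec Bool (suc m) → ℚ
ψValue true  true  K (g ∷ G) = two * 2^∣ K ∣ * boolℚ (peaksCovered true K G)
ψValue true  false K (g ∷ G) = 2^∣ K ∣ * boolℚ (peaksCovered false K G)
ψValue false true  K (g ∷ G) = 2^∣ K ∣ * boolℚ (peaksCovered false K G)
ψValue false false K (g ∷ G) = if g then 0ℚ else 2^∣ K ∣ * boolℚ (peaksCovered false K G)

ψ-X : {m : ℕ} (a b : Bool) (K : Vec Bool m) (u : Perm (suc (suc m))) → ψ (XD (a ∷ b ∷ K)) u ≡ ψValue a b K (Peak u)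
ψ-X {m} a b K u@(perm (i₁ ∷ i₂ ∷ w) _) = begin
    ψ (XD (a ∷ b ∷ K)) u                                ≡⟨ ψ-XD-sum (a ∷ b ∷ K) u ⟩
    ψ-sum x₁ x₂ ys a b K                                 ≡⟨ by-order (ℕ.<-cmp x₁ x₂) ⟩
    ψValue a b K (peaksFrom 0 (Vec.map suc (vals u)))   ≡⟨ cong (ψValue a b K) (sym (Peak-vals u)) ⟩
    ψValue a b K (Peak u)                                ∎
  where
  x₁ x₂ : ℕ
  x₁ = toℕ i₁
  x₂ = toℕ i₂
  ys : Vec ℕ m
  ys = Vec.map toℕ w
  G : Vec Bool m
  G = peaksFrom (suc x₁) (suc x₂ ∷ Vec.map suc ys)
  linked : Linked _≢_ (x₁ ∷ x₂ ∷ ys)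
  linked = vals-neighbours-distinct u
  tail-linked : Linked _≢_ (x₂ ∷ ys)
  tail-linked = Linked.tail linked
  C : Bool → ℚ
  C t = descentCount t x₂ ys K
  by-order : Tri (x₁ < x₂) (x₁ ≡ x₂) (x₂ < x₁) → ψ-sum x₁ x₂ ys a b K ≡ ψValue a b K ((x₂ <ᵇ x₁) ∷ G)
  by-order (tri≈ _ x₁≡x₂ _) = ⊥-elim (Linked.head linked x₁≡x₂)
  by-order (tri< x₁<x₂ _ _) = trans (ψ-sum-rising x₁ x₂ ys a b K x₁<x₂) (rising a b)
    where
    positive : C false ≡ 2^∣ K ∣ * boolℚ (peaksCovered false K G)
    positive = descentCount-positive (suc x₁) x₂ ys K x₁<x₂ tail-linked
    rising : ∀ a b → (if a then (if b then C true else 0ℚ) else 0ℚ) + C false ≡ ψValue a b K ((x₂ <ᵇ x₁) ∷ G)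
    rising true  true  = trans (ℚ.+-comm (C true) (C false)) (descentCount-both (suc x₁) x₂ ys K tail-linked)
    rising true  false = trans (ℚ.+-identityˡ (C false)) positive
    rising false true  = trans (ℚ.+-identityˡ (C false)) positive
    rising false false rewrite <ᵇ-false (ℕ.<-asym x₁<x₂) = trans (ℚ.+-identityˡ (C false)) positive
  by-order (tri> _ _ x₂<x₁) = trans (ψ-sum-falling x₁ x₂ ys a b K x₂<x₁ tail-linked) (falling a b)
    where
    both : C true + C false ≡ two * 2^∣ K ∣ * boolℚ (peaksCovered true K G)
    both = trans (ℚ.+-comm (C true) (C false)) (descentCount-both (suc x₁) x₂ ys K tail-linked)
    half : ½ * (C true + C false) ≡ 2^∣ K ∣ * boolℚ (peaksCovered false K G)
    half = begin
      ½ * (C true + C false)                              ≡⟨ cong (½ *_) both ⟩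
      ½ * (two * 2^∣ K ∣ * boolℚ (peaksCovered true K G))
        ≡⟨ solve 2 (λ p c → con ½ :* ((con 1ℚ :+ con 1ℚ) :* p :* c) := p :* c) refl 2^∣ K ∣ _ ⟩
      2^∣ K ∣ * boolℚ (peaksCovered true K G)
        ≡⟨ cong (λ c → 2^∣ K ∣ * boolℚ c) (peaksCovered-nonpeak x₁ x₂ ys K (<ᵇ-false (ℕ.<-asym x₂<x₁))) ⟩
      2^∣ K ∣ * boolℚ (peaksCovered false K G)            ∎
    falling : ∀ a b → (if a then ½ * (C true + C false) else 0ℚ) + (if b then ½ * (C true + C false) else 0ℚ)
                      ≡ ψValue a b K ((x₂ <ᵇ x₁) ∷ G)
    falling true  true  = trans (solve 1 (λ s → con ½ :* s :+ con ½ :* s := s) refl (C true + C false)) both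
    falling true  false = trans (ℚ.+-identityʳ _) half
    falling false true  = trans (ℚ.+-identityˡ _) half
    falling false false rewrite <ᵇ-true x₂<x₁ = ℚ.+-identityˡ 0ℚ

-- Spanning the functions on peak sets

-- The indicators with the first position in K ignore whether it is a peak, the others vanish when it is:
-- fit the values at peak sets starting with a peak by the former, and the remainder by the latter.
CoverageExpansion : {m : ℕ} → Bool → (Vec Bool m → ℚ) → Set
CoverageExpansion {m} b₀ f =
  Σ (Vec Bool m → ℚ) λ c → ∀ G → T (noConsec G) → f G ≡ ∑[ K ← allVecs m ] c K * boolℚ (peaksCovered b₀ K G)

mutual
  covered-span : (m : ℕ) (f : Vec Bool m → ℚ) → CoverageExpansion false f
  covered-span zero    f = (λ _ → f []) , λ { [] _ → sym (trans (ℚ.+-identityʳ _) (ℚ.*-identityʳ (f []))) }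
  covered-span (suc m) f = c , expansion
    where
    h : Vec Bool (pred m) → ℚ
    h G = f (true ∷ (false ∷′ G))
    S₁ : CoverageExpansion {m} true (h ∘ tail′)
    S₁ = covered-span′ m h
    S₂ : CoverageExpansion false (λ G → f (false ∷ G) - h (tail′ G))
    S₂ = covered-span m (λ G → f (false ∷ G) - h (tail′ G))
    c : Vec Bool (suc m) → ℚ
    c (true ∷ K)  = proj₁ S₁ K
    c (false ∷ K) = proj₁ S₂ K
    expansion : ∀ G → T (noConsec G) → f G ≡ ∑[ K ← allVecs (suc m) ] c K * boolℚ (peaksCovered false K G)
    expansion (false ∷ G) nc = sym (begin
        ∑[ K ← allVecs (suc m) ] c K * boolℚ (peaksCovered false K (false ∷ G))
      ≡⟨ ∑-allVecs-suc m _ ⟩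
        (∑[ K ← allVecs m ] proj₁ S₁ K * boolℚ (peaksCovered true K G))
          + (∑[ K ← allVecs m ] proj₁ S₂ K * boolℚ (peaksCovered false K G))
      ≡⟨ cong₂ _+_ (sym (proj₂ S₁ G nc′)) (sym (proj₂ S₂ G nc′)) ⟩
        h (tail′ G) + (f (false ∷ G) - h (tail′ G))
      ≡⟨ solve 2 (λ x y → x :+ (y :- x) := y) refl (h (tail′ G)) (f (false ∷ G)) ⟩
        f (false ∷ G)
      ∎)
      where
      nc′ : T (noConsec G)
      nc′ = noConsec-tail false G nc
    expansion (true ∷ G) nc = sym (begin
        ∑[ K ← allVecs (suc m) ] c K * boolℚ (peaksCovered false K (true ∷ G))
      ≡⟨ ∑-allVecs-suc m _ ⟩
        (∑[ K ← allVecs m ] proj₁ S₁ K * boolℚ (peaksCovered true K G)) + (∑[ K ← allVecs m ] proj₁ S₂ K * 0ℚ)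
      ≡⟨ cong₂ _+_ (sym (proj₂ S₁ G (noConsec-tail true G nc))) (∑-zero (allVecs m) (λ K → ℚ.*-zeroʳ (proj₁ S₂ K))) ⟩
        h (tail′ G) + 0ℚ
      ≡⟨ trans (ℚ.+-identityʳ _) (cong (λ G → f (true ∷ G)) (sym (noConsec-after-true G nc))) ⟩
        f (true ∷ G)
      ∎)

  covered-span′ : (m : ℕ) (h : Vec Bool (pred m) → ℚ) → CoverageExpansion {m} true (h ∘ tail′)
  covered-span′ zero    h = (λ _ → h []) , λ { [] _ → sym (trans (ℚ.+-identityʳ _) (ℚ.*-identityʳ (h []))) }
  covered-span′ (suc m) h = c , expansion
    where
    S : CoverageExpansion false h
    S = covered-span m h
    c : Vec Bool (suc m) → ℚ
    c (true ∷ K)  = 0ℚ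
    c (false ∷ K) = proj₁ S K
    expansion : ∀ G → T (noConsec G) → h (tail′ G) ≡ ∑[ K ← allVecs (suc m) ] c K * boolℚ (peaksCovered true K G)
    expansion (g ∷ G) nc = sym (begin
        ∑[ K ← allVecs (suc m) ] c K * boolℚ (peaksCovered true K (g ∷ G))
      ≡⟨ ∑-allVecs-suc m _ ⟩
        (∑[ K ← allVecs m ] 0ℚ * boolℚ (peaksCovered true K G))
          + (∑[ K ← allVecs m ] proj₁ S K * boolℚ (peaksCovered false K G))
      ≡⟨ cong₂ _+_ (∑-zero (allVecs m) (λ K → ℚ.*-zeroˡ (boolℚ (peaksCovered true K G)))) (sym (proj₂ S G (noConsec-tail g G nc))) ⟩
        0ℚ + h G
      ≡⟨ ℚ.+-identityˡ (h G) ⟩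
        h G
      ∎)

2^-∣_∣ : {k : ℕ} → Vec Bool k → ℚ
2^-∣ []        ∣ = 1ℚ
2^-∣ true ∷ K  ∣ = ½ * 2^-∣ K ∣
2^-∣ false ∷ K ∣ = 2^-∣ K ∣

2^-∣∣-cancel : {k : ℕ} (K : Vec Bool k) (d e : ℚ) → d * 2^-∣ K ∣ * (2^∣ K ∣ * e) ≡ d * e
2^-∣∣-cancel []          d e = trans (cong (_* (1ℚ * e)) (ℚ.*-identityʳ d)) (cong (d *_) (ℚ.*-identityˡ e))
2^-∣∣-cancel (false ∷ K) d e = 2^-∣∣-cancel K d e
2^-∣∣-cancel (true ∷ K)  d e = trans
  (solve 4 (λ d i p e → d :* (con ½ :* i) :* ((con 1ℚ :+ con 1ℚ) :* p :* e) := d :* i :* (p :* e)) refl d 2^-∣ K ∣ 2^∣ K ∣ e)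
  (2^-∣∣-cancel K d e)

rescaled : {m : ℕ} {b₀ : Bool} {f : Vec Bool m → ℚ} → CoverageExpansion b₀ f → Vec Bool m → ℚ
rescaled S K = proj₁ S K * 2^-∣ K ∣

rescaled-expansion : {m : ℕ} {f : Vec Bool m → ℚ} (S : CoverageExpansion false f) (G : Vec Bool m) → T (noConsec G) →
                     ∑[ K ← allVecs m ] rescaled S K * (2^∣ K ∣ * boolℚ (peaksCovered false K G)) ≡ f G
rescaled-expansion {m} S G nc =
  trans (∑-cong (allVecs m) (λ K → 2^-∣∣-cancel K (proj₁ S K) (boolℚ (peaksCovered false K G)))) (sym (proj₂ S G nc))

ψ-cong : {n : ℕ} (x x′ : DPerm n → ℚ) → x ≈ x′ → ψ x ≈ ψ x′
ψ-cong {n} x x′ x≈x′ u = ∑-cong (allVecs n) (λ ε → term ε (T? (evenᵛ ε)))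
  where
  term : ∀ ε d → evenTerm x u ε d ≡ evenTerm x′ u ε d
  term ε (yes even) = x≈x′ (dperm u ε even)
  term ε (no _)     = refl

ψ-lc : {n : ℕ} {I : Set} (idx : List I) (c : I → ℚ) (e : I → DPerm n → ℚ) (u : Perm n) →
       ψ (lc idx c e) u ≡ ∑[ i ← idx ] c i * ψ (e i) u
ψ-lc {n} idx c e u = begin
    ψ (lc idx c e) u
  ≡⟨ ∑-cong (allVecs n) (λ ε → term ε (T? (evenᵛ ε))) ⟩
    ∑[ ε ← allVecs n ] ∑[ i ← idx ] c i * evenTerm (e i) u ε (T? (evenᵛ ε))
  ≡⟨ ∑-comm (allVecs n) idx _ ⟩
    ∑[ i ← idx ] ∑[ ε ← allVecs n ] c i * evenTerm (e i) u ε (T? (evenᵛ ε))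
  ≡⟨ ∑-cong idx (λ i → ∑-*ˡ (allVecs n) (c i) _) ⟩
    ∑[ i ← idx ] c i * ψ (e i) u
  ∎
  where
  term : ∀ ε d → evenTerm (lc idx c e) u ε d ≡ ∑[ i ← idx ] c i * evenTerm (e i) u ε d
  term ε (yes _) = refl
  term ε (no _)  = sym (∑-zero idx (λ i → ℚ.*-zeroʳ (c i)))

φ-cong : {m : ℕ} (y y′ : SPerm m → ℚ) → y ≈ y′ → φ y ≈ φ y′
φ-cong {m} y y′ y≈y′ v = ∑-cong (allVecs m) (λ ε → y≈y′ (sperm v ε))

φ-lc : {m : ℕ} {I : Set} (idx : List I) (c : I → ℚ) (e : I → SPerm m → ℚ) (v : Perm m) →
       φ (lc idx c e) v ≡ ∑[ i ← idx ] c i * φ (e i) v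
φ-lc {m} idx c e v = trans (∑-comm (allVecs m) idx (λ ε i → c i * e i (sperm v ε)))
                           (∑-cong idx (λ i → ∑-*ˡ (allVecs m) (c i) (λ ε → e i (sperm v ε))))

peakExpansion : {k : ℕ} → List (Vec Bool k) → (Vec Bool k → ℚ) → Vec Bool k → ℚ
peakExpansion idx c G = ∑[ F ← idx ] c F * boolℚ (G ≡ᵇᵥ F)

peakExpansion-filter : {k : ℕ} (P : Vec Bool k → Bool) (f : Vec Bool k → ℚ) (G : Vec Bool k) → T (P G) →
                       peakExpansion (filter (T? ∘ P) (allVecs k)) f G ≡ f G
peakExpansion-filter {k} P f G PG = begin
    peakExpansion (filter (T? ∘ P) (allVecs k)) f G
  ≡⟨ ∑-filter (allVecs k) P _ ⟩
    ∑[ F ← allVecs k ] (if P F then f F * boolℚ (G ≡ᵇᵥ F) else 0ℚ)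
  ≡⟨ ∑-cong (allVecs k) (λ F → if-*ʳ (P F) (f F) (boolℚ (G ≡ᵇᵥ F))) ⟩
    ∑[ F ← allVecs k ] (if P F then f F else 0ℚ) * boolℚ (G ≡ᵇᵥ F)
  ≡⟨ ∑-δ k (λ F → if P F then f F else 0ℚ) G ⟩
    (if P G then f G else 0ℚ)
  ≡⟨ selected (P G) PG ⟩
    f G
  ∎
  where
  selected : ∀ b → T b → (if b then f G else 0ℚ) ≡ f G
  selected true _ = refl

Inℙ-intro : {n : ℕ} (z : Perm n → ℚ) (f : Vec Bool (pred n) → ℚ) → (∀ u → z u ≡ f (Peak u)) → Inℙ n z
Inℙ-intro z f z≗f = f , λ u → trans (z≗f u) (sym (peakExpansion-filter noConsec f (Peak u) (Peak-noConsec u)))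

Inℙ̊-intro : {n : ℕ} (z : Perm n → ℚ) (f : Vec Bool (pred n) → ℚ) → (∀ u → z u ≡ f (PeakRing u)) → Inℙ̊ n z
Inℙ̊-intro z f z≗f = f , λ u → trans (z≗f u)
  (sym (peakExpansion-filter (λ F → noConsec F ∧ not (has1 F)) f (PeakRing u) (remove1-admissible (Peak u) (Peak-noConsec u))))
  where
  remove1-admissible : ∀ {k} (G : Vec Bool k) → T (noConsec G) → T (noConsec (remove1 G) ∧ not (has1 (remove1 G)))
  remove1-admissible []          _  = tt
  remove1-admissible (a ∷ [])    _  = tt
  remove1-admissible (a ∷ b ∷ G) nc = subst T (sym (∧-identityʳ _)) (noConsec-tail a (b ∷ G) nc)

fixParity : {k : ℕ} → Vec Bool k → Bool
fixParity ε = not (evenᵛ ε)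

even-fixParity : {k : ℕ} (ε : Vec Bool k) → T (evenᵛ (fixParity ε ∷ ε))
even-fixParity ε with evenᵛ ε in eq
... | true  = subst T (sym eq) tt
... | false = subst (T ∘ not) (sym eq) tt

even-fixParity-second : {k : ℕ} (a : Bool) (ε : Vec Bool k) → T (evenᵛ (a ∷ fixParity (a ∷ ε) ∷ ε))
even-fixParity-second a ε = subst (T ∘ evenᵇ) (countTrue-swap (fixParity (a ∷ ε)) a) (even-fixParity (a ∷ ε))
  where
  countTrue-swap : ∀ x y → countTrue (x ∷ y ∷ ε) ≡ countTrue (y ∷ x ∷ ε)
  countTrue-swap false false = refl
  countTrue-swap false true  = refl
  countTrue-swap true  false = refl
  countTrue-swap true  true  = refl

liftD₁₂ liftD₂₁ : {m : ℕ} → Bool → SPerm m → DPerm (suc (suc m))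
liftD₁₂ a (sperm v ε) = dperm (lift12 v) (fixParity (a ∷ ε) ∷ a ∷ ε) (even-fixParity (a ∷ ε))
liftD₂₁ a (sperm v ε) = dperm (lift21 v) (a ∷ fixParity (a ∷ ε) ∷ ε) (even-fixParity-second a ε)

descents-lifted : {k : ℕ} (t : Bool) (p : ℕ) (ε : Vec Bool k) (zs : Vec ℕ k) → p ≤ 1 →
                  descents t p ε (Vec.map suc (Vec.map suc zs)) ≡ descentsFrom (ℤ.+ 0) (Vec.zipWith signed ε zs)
descents-lifted t p []      []       p≤1 = refl
descents-lifted t p (s ∷ ε) (z ∷ zs) p≤1 = begin
    signedGt t p s (suc (suc z)) ∷ descents s (suc (suc z)) ε (Vec.map suc (Vec.map suc zs))
  ≡⟨ cong₂ _∷_ (signedGt-< t s (s≤s (ℕ.≤-trans p≤1 (s≤s z≤n))))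
               (trans (descents-shift s (suc z) ε (Vec.map suc zs)) (descents-shift s z ε zs)) ⟩
    s ∷ descents s z ε zs
  ≡⟨ sym (descentsFrom-zero s z ε zs) ⟩
    descentsFrom (ℤ.+ 0) (Vec.zipWith signed (s ∷ ε) (z ∷ zs))
  ∎

DesD-liftD₁₂ : {m : ℕ} (a : Bool) (w : SPerm m) → DesD (liftD₁₂ a w) ≡ a ∷ a ∷ DesB w
DesD-liftD₁₂ a (sperm v ε) = begin
    desDvec (entries (lift12 v) (s ∷ a ∷ ε))
  ≡⟨ cong desDvec (trans (entries-signed (lift12 v) (s ∷ a ∷ ε)) (cong (Vec.zipWith signed (s ∷ a ∷ ε)) (vals-lift12 v))) ⟩
    desDvec (Vec.zipWith signed (s ∷ a ∷ ε) (0 ∷ 1 ∷ Vec.map suc (Vec.map suc (vals v))))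
  ≡⟨ desDvec-signed s a 0 1 ε _ ⟩
    signedGt (not s) 0 a 1 ∷ signedGt s 0 a 1 ∷ descents a 1 ε (Vec.map suc (Vec.map suc (vals v)))
  ≡⟨ cong₂ _∷_ (signedGt-< (not s) a (s≤s z≤n)) (cong₂ _∷_ (signedGt-< s a (s≤s z≤n)) (descents-lifted a 1 ε (vals v) ℕ.≤-refl)) ⟩
    a ∷ a ∷ descentsFrom (ℤ.+ 0) (Vec.zipWith signed ε (vals v))
  ≡⟨ cong (λ D → a ∷ a ∷ D) (sym (DesB-signed v ε)) ⟩
    a ∷ a ∷ DesB (sperm v ε)
  ∎
  where
  s : Bool
  s = fixParity (a ∷ ε)

DesD-liftD₂₁ : {m : ℕ} (a : Bool) (w : SPerm m) → DesD (liftD₂₁ a w) ≡ a ∷ not a ∷ DesB w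
DesD-liftD₂₁ a (sperm v ε) = begin
    desDvec (entries (lift21 v) (a ∷ s ∷ ε))
  ≡⟨ cong desDvec (trans (entries-signed (lift21 v) (a ∷ s ∷ ε)) (cong (Vec.zipWith signed (a ∷ s ∷ ε)) (vals-lift21 v))) ⟩
    desDvec (Vec.zipWith signed (a ∷ s ∷ ε) (1 ∷ 0 ∷ Vec.map suc (Vec.map suc (vals v))))
  ≡⟨ desDvec-signed a s 1 0 ε _ ⟩
    signedGt (not a) 1 s 0 ∷ signedGt a 1 s 0 ∷ descents s 0 ε (Vec.map suc (Vec.map suc (vals v)))
  ≡⟨ cong₂ _∷_ (trans (signedGt-> (not a) s (s≤s z≤n)) (not-involutive a))
               (cong₂ _∷_ (signedGt-> a s (s≤s z≤n)) (descents-lifted s 0 ε (vals v) z≤n)) ⟩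
    a ∷ not a ∷ descentsFrom (ℤ.+ 0) (Vec.zipWith signed ε (vals v))
  ≡⟨ cong (λ D → a ∷ not a ∷ D) (sym (DesB-signed v ε)) ⟩
    a ∷ not a ∷ DesB (sperm v ε)
  ∎
  where
  s : Bool
  s = fixParity (a ∷ ε)

-- Inclusion–exclusion over the four lifts of w whose D-descent sets are DesB(w) + 2 with each choice of
-- 1' and 1: on X_J it leaves X_{J-2} if 1, 1' ∉ J and 0 otherwise.
γ-map : {m : ℕ} → (DPerm (suc (suc m)) → ℚ) → SPerm m → ℚ
γ-map x w = (x (liftD₁₂ false w) + x (liftD₁₂ true w)) - (x (liftD₂₁ true w) + x (liftD₂₁ false w))

γ-map-cong : {m : ℕ} (x x′ : DPerm (suc (suc m)) → ℚ) → x ≈ x′ → γ-map x ≈ γ-map x′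
γ-map-cong x x′ x≈x′ w = cong₂ _-_ (cong₂ _+_ (x≈x′ _) (x≈x′ _)) (cong₂ _+_ (x≈x′ _) (x≈x′ _))

γ-map-lc : {m : ℕ} {I : Set} (idx : List I) (c : I → ℚ) (e : I → DPerm (suc (suc m)) → ℚ) (w : SPerm m) →
           γ-map (lc idx c e) w ≡ ∑[ i ← idx ] c i * γ-map (e i) w
γ-map-lc {I = I} idx c e w = sym (begin
    ∑[ i ← idx ] c i * ((e₀₀ i + e₁₁ i) - (e₁₀ i + e₀₁ i))
  ≡⟨ ∑-cong idx (λ i → solve 5 (λ c a b d e → c :* ((a :+ b) :- (d :+ e)) := (c :* a :+ c :* b) :- (c :* d :+ c :* e))
                                refl (c i) (e₀₀ i) (e₁₁ i) (e₁₀ i) (e₀₁ i)) ⟩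
    ∑[ i ← idx ] ((c i * e₀₀ i + c i * e₁₁ i) - (c i * e₁₀ i + c i * e₀₁ i))
  ≡⟨ ∑-- idx _ _ ⟩
    (∑[ i ← idx ] (c i * e₀₀ i + c i * e₁₁ i)) - (∑[ i ← idx ] (c i * e₁₀ i + c i * e₀₁ i))
  ≡⟨ cong₂ _-_ (∑-+ idx _ _) (∑-+ idx _ _) ⟩
    γ-map (lc idx c e) w
  ∎)
  where
  e₀₀ e₁₁ e₁₀ e₀₁ : I → ℚ
  e₀₀ i = e i (liftD₁₂ false w)
  e₁₁ i = e i (liftD₁₂ true w)
  e₁₀ i = e i (liftD₂₁ true w)
  e₀₁ i = e i (liftD₂₁ false w)

γ-map-X : {m : ℕ} (J : Vec Bool (suc (suc m))) (w : SPerm m) → γ-map (XD J) w ≡ γX m J w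
γ-map-X {m} (j₁ ∷ j₂ ∷ K) w = begin
    γ-map (XD (j₁ ∷ j₂ ∷ K)) w
  ≡⟨ cong₂ _-_ (cong₂ _+_ (at (liftD₁₂ false w) (DesD-liftD₁₂ false w)) (at (liftD₁₂ true w) (DesD-liftD₁₂ true w)))
               (cong₂ _+_ (at (liftD₂₁ true w) (DesD-liftD₂₁ true w)) (at (liftD₂₁ false w) (DesD-liftD₂₁ false w))) ⟩
    (boolℚ ((false ∷ false ∷ DesB w) ⊆ᵇ J) + boolℚ ((true ∷ true ∷ DesB w) ⊆ᵇ J))
      - (boolℚ ((true ∷ false ∷ DesB w) ⊆ᵇ J) + boolℚ ((false ∷ true ∷ DesB w) ⊆ᵇ J))
  ≡⟨ inclusion-exclusion j₁ j₂ ⟩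
    γX m J w
  ∎
  where
  J : Vec Bool (suc (suc m))
  J = j₁ ∷ j₂ ∷ K
  d : ℚ
  d = boolℚ (DesB w ⊆ᵇ K)
  at : ∀ W {D} → DesD W ≡ D → XD J W ≡ boolℚ (D ⊆ᵇ J)
  at W DesD≡D = trans (XD-apply J W) (cong (λ D → boolℚ (D ⊆ᵇ J)) DesD≡D)
  inclusion-exclusion : ∀ j₁ j₂ →
    (boolℚ ((false ∷ false ∷ DesB w) ⊆ᵇ (j₁ ∷ j₂ ∷ K)) + boolℚ ((true ∷ true ∷ DesB w) ⊆ᵇ (j₁ ∷ j₂ ∷ K)))
      - (boolℚ ((true ∷ false ∷ DesB w) ⊆ᵇ (j₁ ∷ j₂ ∷ K)) + boolℚ ((false ∷ true ∷ DesB w) ⊆ᵇ (j₁ ∷ j₂ ∷ K)))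
    ≡ γX m (j₁ ∷ j₂ ∷ K) w
  inclusion-exclusion false false = trans (solve 1 (λ d → (d :+ con 0ℚ) :- (con 0ℚ :+ con 0ℚ) := d) refl d) (sym (XB-apply K w))
  inclusion-exclusion true  true  = ℚ.+-inverseʳ (d + d)
  inclusion-exclusion true  false = ℚ.+-inverseʳ (d + 0ℚ)
  inclusion-exclusion false true  = solve 1 (λ d → (d :+ con 0ℚ) :- (con 0ℚ :+ d) := con 0ℚ) refl d

-- 1 2 (v+2) and 2 1 (v+2) have peak set Peak(v) + 2, without and with the peak 1.
π-map : {m : ℕ} → (Perm (suc (suc m)) → ℚ) → Perm m → ℚ
π-map z v = z (lift12 v) - z (lift21 v)

π-map-cong : {m : ℕ} (z z′ : Perm (suc (suc m)) → ℚ) → z ≈ z′ → π-map z ≈ π-map z′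
π-map-cong z z′ z≈z′ v = cong₂ _-_ (z≈z′ _) (z≈z′ _)

π-map-lc : {m : ℕ} {I : Set} (idx : List I) (c : I → ℚ) (e : I → Perm (suc (suc m)) → ℚ) (v : Perm m) →
           π-map (lc idx c e) v ≡ ∑[ i ← idx ] c i * π-map (e i) v
π-map-lc idx c e v = sym (trans
  (∑-cong idx (λ i → solve 3 (λ c a b → c :* (a :- b) := c :* a :- c :* b) refl (c i) (e i (lift12 v)) (e i (lift21 v))))
  (∑-- idx _ _))

π-map-P : {m : ℕ} (F : Vec Bool (suc m)) (v : Perm m) → π-map (PP F) v ≡ πP m F v
π-map-P {zero} (true  ∷ []) (perm [] _) = refl
π-map-P {zero} (false ∷ []) (perm [] _) = refl
π-map-P {suc m} (f₁ ∷ f₂ ∷ F) v = begin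
    boolℚ (Peak (lift12 v) ≡ᵇᵥ (f₁ ∷ f₂ ∷ F)) - boolℚ (Peak (lift21 v) ≡ᵇᵥ (f₁ ∷ f₂ ∷ F))
  ≡⟨ cong₂ (λ P P′ → boolℚ (P ≡ᵇᵥ (f₁ ∷ f₂ ∷ F)) - boolℚ (P′ ≡ᵇᵥ (f₁ ∷ f₂ ∷ F))) (Peak-lift12 v) (Peak-lift21 v) ⟩
    boolℚ ((false ∷ false ∷ Peak v) ≡ᵇᵥ (f₁ ∷ f₂ ∷ F)) - boolℚ ((true ∷ false ∷ Peak v) ≡ᵇᵥ (f₁ ∷ f₂ ∷ F))
  ≡⟨ cong₂ (λ E E′ → boolℚ E - boolℚ E′) (heads false) (heads true) ⟩
    boolℚ (not (false xor f₁) ∧ (not (false xor f₂) ∧ E)) - boolℚ (not (true xor f₁) ∧ (not (false xor f₂) ∧ E))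
  ≡⟨ by-heads f₁ f₂ ⟩
    πP (suc m) (f₁ ∷ f₂ ∷ F) v
  ∎
  where
  E : Bool
  E = Peak v ≡ᵇᵥ F
  heads : ∀ a → ((a ∷ false ∷ Peak v) ≡ᵇᵥ (f₁ ∷ f₂ ∷ F)) ≡ not (a xor f₁) ∧ (not (false xor f₂) ∧ E)
  heads a = trans (≡ᵇᵥ-∷ a f₁ (false ∷ Peak v) (f₂ ∷ F)) (cong (not (a xor f₁) ∧_) (≡ᵇᵥ-∷ false f₂ (Peak v) F))
  by-heads : ∀ f₁ f₂ → boolℚ (not (false xor f₁) ∧ (not (false xor f₂) ∧ E)) - boolℚ (not (true xor f₁) ∧ (not (false xor f₂) ∧ E))
                       ≡ πP (suc m) (f₁ ∷ f₂ ∷ F) v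
  by-heads false false = ℚ.+-identityʳ (boolℚ E)
  by-heads true  false = ℚ.+-identityˡ (- boolℚ E)
  by-heads false true  = refl
  by-heads true  true  = refl

lc-γX : {m : ℕ} (c : Vec Bool (suc (suc m)) → ℚ) (w : SPerm m) →
        lc (allVecs (suc (suc m))) c (γX m) w ≡ ∑[ K ← allVecs m ] c (false ∷ false ∷ K) * XB K w
lc-γX {m} c w = begin
    lc (allVecs (suc (suc m))) c (γX m) w
  ≡⟨ ∑-allVecs-2+ m _ ⟩
    ((∑[ K ← allVecs m ] c (true ∷ true ∷ K) * 0ℚ) + (∑[ K ← allVecs m ] c (true ∷ false ∷ K) * 0ℚ))
      + ((∑[ K ← allVecs m ] c (false ∷ true ∷ K) * 0ℚ) + (∑[ K ← allVecs m ] c (false ∷ false ∷ K) * XB K w))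
  ≡⟨ cong₂ _+_ (cong₂ _+_ (vanish true true) (vanish true false))
               (cong (_+ (∑[ K ← allVecs m ] c (false ∷ false ∷ K) * XB K w)) (vanish false true)) ⟩
    (0ℚ + 0ℚ) + (0ℚ + (∑[ K ← allVecs m ] c (false ∷ false ∷ K) * XB K w))
  ≡⟨ solve 1 (λ s → (con 0ℚ :+ con 0ℚ) :+ (con 0ℚ :+ s) := s) refl (∑[ K ← allVecs m ] c (false ∷ false ∷ K) * XB K w) ⟩
    ∑[ K ← allVecs m ] c (false ∷ false ∷ K) * XB K w
  ∎
  where
  vanish : ∀ a b → ∑[ K ← allVecs m ] c (a ∷ b ∷ K) * 0ℚ ≡ 0ℚ
  vanish a b = ∑-zero (allVecs m) (λ K → ℚ.*-zeroʳ (c (a ∷ b ∷ K)))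

-- Exactness and the vertical maps

γ-map-basis : {m : ℕ} (c : Vec Bool (suc (suc m)) → ℚ) → γ-map (lc (allVecs (suc (suc m))) c XD) ≈ lc (allVecs (suc (suc m))) c (γX m)
γ-map-basis {m} c w = trans (γ-map-lc (allVecs (suc (suc m))) c XD w) (∑-cong (allVecs (suc (suc m))) (λ J → cong (c J *_) (γ-map-X J w)))

γ-map-expansion : {m : ℕ} {x : DPerm (suc (suc m)) → ℚ} (c : Vec Bool (suc (suc m)) → ℚ) →
                  x ≈ lc (allVecs (suc (suc m))) c XD → ∀ w → γ-map x w ≡ ∑[ K ← allVecs m ] c (false ∷ false ∷ K) * XB K w
γ-map-expansion {x = x} c x≈ w = trans (γ-map-cong x _ x≈ w) (trans (γ-map-basis c w) (lc-γX c w))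

restrict-1'1 : {n : ℕ} → (Vec Bool n → ℚ) → Vec Bool n → ℚ
restrict-1'1 c J = if has1'or1 J then c J else 0ℚ

InI⇒InΣD : {n : ℕ} (x : DPerm n → ℚ) → InI n x → InΣD n x
InI⇒InΣD {n} x (c , x≈) = restrict-1'1 c , λ w → trans (x≈ w) (lc-filter (allVecs n) has1'or1 c XD w)

γ-kernel⇒InI : {m : ℕ} (x : DPerm (suc (suc m)) → ℚ) → InΣD (suc (suc m)) x → γ-map x ≈ zeroV → InI (suc (suc m)) x
γ-kernel⇒InI {m} x (c , x≈) γx≈0 =
  c , λ w → trans (x≈ w) (trans (∑-cong (allVecs (suc (suc m))) (λ J → supported J w)) (sym (lc-filter (allVecs _) has1'or1 c XD w)))
  where
  c₀₀ : Vec Bool m → ℚ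
  c₀₀ K = c (false ∷ false ∷ K)
  at-identity : ∀ L K → XB K (sperm (identity m) L) ≡ boolℚ (L ⊆ᵇ K)
  at-identity L K = trans (XB-apply K (sperm (identity m) L)) (cong (λ D → boolℚ (D ⊆ᵇ K)) (DesB-identity m L))
  vanishes : ∀ K → c₀₀ K ≡ 0ℚ
  vanishes = zeta-injective m c₀₀ λ L → begin
      ∑[ K ← allVecs m ] c₀₀ K * boolℚ (L ⊆ᵇ K)             ≡⟨ ∑-cong (allVecs m) (λ K → cong (c₀₀ K *_) (sym (at-identity L K))) ⟩
      ∑[ K ← allVecs m ] c₀₀ K * XB K (sperm (identity m) L) ≡⟨ sym (γ-map-expansion c x≈ (sperm (identity m) L)) ⟩
      γ-map x (sperm (identity m) L)                          ≡⟨ γx≈0 (sperm (identity m) L) ⟩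
      0ℚ                                                      ∎
  supported : ∀ J w → c J * XD J w ≡ restrict-1'1 c J * XD J w
  supported (true  ∷ b    ∷ K) w = refl
  supported (false ∷ true  ∷ K) w = refl
  supported (false ∷ false ∷ K) w = cong (_* XD (false ∷ false ∷ K) w) (vanishes K)

InI⇒γ-kernel : {m : ℕ} (x : DPerm (suc (suc m)) → ℚ) → InI (suc (suc m)) x → γ-map x ≈ zeroV
InI⇒γ-kernel {m} x (c , x≈) w =
  trans (γ-map-expansion (restrict-1'1 c) (proj₂ (InI⇒InΣD x (c , x≈))) w) (∑-zero (allVecs m) (λ K → ℚ.*-zeroˡ (XB K w)))

γ-into-ΣB : {m : ℕ} (x : DPerm (suc (suc m)) → ℚ) → InΣD (suc (suc m)) x → InΣB m (γ-map x)
γ-into-ΣB x (c , x≈) = (λ K → c (false ∷ false ∷ K)) , γ-map-expansion c x≈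

γ-onto-ΣB : {m : ℕ} (y : SPerm m → ℚ) → InΣB m y → ∃ λ x → InΣD (suc (suc m)) x × γ-map x ≈ y
γ-onto-ΣB {m} y (c , y≈) =
  lc (allVecs (suc (suc m))) c′ XD , (c′ , λ _ → refl) , λ w → trans (γ-map-expansion c′ (λ _ → refl) w) (sym (y≈ w))
  where
  c′ : Vec Bool (suc (suc m)) → ℚ
  c′ (a ∷ b ∷ K) = if a ∨ b then 0ℚ else c K

π-map-basis : {m : ℕ} (c : Vec Bool (suc m) → ℚ) → π-map (lc (𝓕 (suc (suc m))) c PP) ≈ lc (𝓕 (suc (suc m))) c (πP m)
π-map-basis {m} c v = trans (π-map-lc (𝓕 (suc (suc m))) c PP v) (∑-cong (𝓕 (suc (suc m))) (λ F → cong (c F *_) (π-map-P F v)))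

ℙ̊⇒ℙ : {n : ℕ} (z : Perm n → ℚ) → Inℙ̊ n z → Inℙ n z
ℙ̊⇒ℙ {n} z (c , z≈) = Inℙ-intro z (peakExpansion (𝓕̊ n) c ∘ remove1) z≈

π-kernel⇒ℙ̊ : {m : ℕ} (z : Perm (suc (suc m)) → ℚ) → Inℙ (suc (suc m)) z → π-map z ≈ zeroV → Inℙ̊ (suc (suc m)) z
π-kernel⇒ℙ̊ {m} z (c , z≈) πz≈0 = Inℙ̊-intro z h (λ u → trans (z≈ u) (first-peak-irrelevant (Peak u) (Peak-noConsec u)))
  where
  h : Vec Bool (suc m) → ℚ
  h = peakExpansion (𝓕 (suc (suc m))) c
  balanced : ∀ v → h (false ∷ (false ∷′ Peak v)) ≡ h (true ∷ (false ∷′ Peak v))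
  balanced v = x∙y⁻¹≈ε⇒x≈y _ _ (trans (cong₂ _-_ (trans (cong h (sym (Peak-lift12 v))) (sym (z≈ (lift12 v))))
                                                  (trans (cong h (sym (Peak-lift21 v))) (sym (z≈ (lift21 v)))))
                                       (πz≈0 v))
  first-peak-irrelevant : ∀ P → T (noConsec P) → h P ≡ h (remove1 P)
  first-peak-irrelevant (false ∷ G) _  = refl
  first-peak-irrelevant (true ∷ G)  nc with peak-realisable m (tail′ G) (tail-noConsec G (noConsec-tail true G nc))
  ... | v , Peak-v = begin
      h (true ∷ G)                   ≡⟨ cong (λ G → h (true ∷ G)) (trans (noConsec-after-true G nc) (cong (false ∷′_) (sym Peak-v))) ⟩
      h (true ∷ (false ∷′ Peak v))   ≡⟨ sym (balanced v) ⟩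
      h (false ∷ (false ∷′ Peak v))  ≡⟨ cong (λ G → h (false ∷ G)) (trans (cong (false ∷′_) Peak-v) (sym (noConsec-after-true G nc))) ⟩
      h (false ∷ G)                  ∎

ℙ̊⇒π-kernel : {m : ℕ} (z : Perm (suc (suc m)) → ℚ) → Inℙ̊ (suc (suc m)) z → π-map z ≈ zeroV
ℙ̊⇒π-kernel {m} z (c , z≈) v = trans (cong₂ _-_ (trans (z≈ (lift12 v)) (cong (h ∘ remove1) (Peak-lift12 v)))
                                               (trans (z≈ (lift21 v)) (cong (h ∘ remove1) (Peak-lift21 v))))
                                    (ℚ.+-inverseʳ (h (false ∷ (false ∷′ Peak v))))
  where
  h : Vec Bool (suc m) → ℚ
  h = peakExpansion (𝓕̊ (suc (suc m))) c

π-into-ℙ : {m : ℕ} (z : Perm (suc (suc m)) → ℚ) → Inℙ (suc (suc m)) z → Inℙ m (π-map z)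
π-into-ℙ {m} z (c , z≈) = Inℙ-intro (π-map z) (λ P → h (false ∷ (false ∷′ P)) - h (true ∷ (false ∷′ P)))
  (λ v → cong₂ _-_ (trans (z≈ (lift12 v)) (cong h (Peak-lift12 v))) (trans (z≈ (lift21 v)) (cong h (Peak-lift21 v))))
  where
  h : Vec Bool (suc m) → ℚ
  h = peakExpansion (𝓕 (suc (suc m))) c

π-onto-ℙ : {m : ℕ} (z : Perm m → ℚ) → Inℙ m z → ∃ λ z′ → Inℙ (suc (suc m)) z′ × π-map z′ ≈ z
π-onto-ℙ {m} z (c , z≈) = lifted ∘ Peak , Inℙ-intro (lifted ∘ Peak) lifted (λ _ → refl) , projects
  where
  h : Vec Bool (pred m) → ℚ
  h = peakExpansion (𝓕 m) c
  lifted : Vec Bool (suc m) → ℚ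
  lifted (g ∷ G) = if g then 0ℚ else h (tail′ G)
  tail′-∷′ : ∀ {k} (P : Vec Bool (pred k)) → tail′ {k} (false ∷′ P) ≡ P
  tail′-∷′ {zero}  [] = refl
  tail′-∷′ {suc k} P  = refl
  projects : ∀ v → π-map (lifted ∘ Peak) v ≡ z v
  projects v = begin
      lifted (Peak (lift12 v)) - lifted (Peak (lift21 v)) ≡⟨ cong₂ (λ P P′ → lifted P - lifted P′) (Peak-lift12 v) (Peak-lift21 v) ⟩
      h (tail′ {m} (false ∷′ Peak v)) - 0ℚ                ≡⟨ ℚ.+-identityʳ _ ⟩
      h (tail′ {m} (false ∷′ Peak v))                     ≡⟨ cong h (tail′-∷′ {m} (Peak v)) ⟩
      h (Peak v)                                          ≡⟨ sym (z≈ v) ⟩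
      z v                                                 ∎

ψX : {m : ℕ} → Vec Bool (suc (suc m)) → Vec Bool (suc m) → ℚ
ψX (a ∷ b ∷ K) = ψValue a b K

ψ-expansion : {m : ℕ} {x : DPerm (suc (suc m)) → ℚ} (idx : List (Vec Bool (suc (suc m)))) (c : Vec Bool (suc (suc m)) → ℚ) →
              x ≈ lc idx c XD → ∀ u → ψ x u ≡ ∑[ J ← idx ] c J * ψX J (Peak u)
ψ-expansion {x = x} idx c x≈ u = trans (ψ-cong x _ x≈ u) (trans (ψ-lc idx c XD u) (∑-cong idx at))
  where
  at : ∀ J → c J * ψ (XD J) u ≡ c J * ψX J (Peak u)
  at (a ∷ b ∷ K) = cong (c (a ∷ b ∷ K) *_) (ψ-X a b K u)

ψΣ-into-ℙ : {m : ℕ} (x : DPerm (suc (suc m)) → ℚ) → InΣD (suc (suc m)) x → Inℙ (suc (suc m)) (ψ x)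
ψΣ-into-ℙ {m} x (c , x≈) = Inℙ-intro (ψ x) (λ P → ∑[ J ← allVecs (suc (suc m)) ] c J * ψX J P) (ψ-expansion (allVecs _) c x≈)

ψI-into-ℙ̊ : {m : ℕ} (x : DPerm (suc (suc m)) → ℚ) → InI (suc (suc m)) x → Inℙ̊ (suc (suc m)) (ψ x)
ψI-into-ℙ̊ {m} x (c , x≈) = Inℙ̊-intro (ψ x) f (λ u → trans (ψ-expansion (idxI _) c x≈ u) (first-peak-irrelevant (Peak u)))
  where
  f : Vec Bool (suc m) → ℚ
  f P = ∑[ J ← idxI (suc (suc m)) ] c J * ψX J P
  first-peak-irrelevant : ∀ P → f P ≡ f (remove1 P)
  first-peak-irrelevant (g ∷ G) = trans (∑-filter (allVecs (suc (suc m))) has1'or1 (λ J → c J * ψX J (g ∷ G)))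
    (trans (∑-cong (allVecs _) same) (sym (∑-filter (allVecs (suc (suc m))) has1'or1 (λ J → c J * ψX J (false ∷ G)))))
    where
    same : ∀ J → (if has1'or1 J then c J * ψX J (g ∷ G) else 0ℚ) ≡ (if has1'or1 J then c J * ψX J (false ∷ G) else 0ℚ)
    same (true  ∷ true  ∷ K) = refl
    same (true  ∷ false ∷ K) = refl
    same (false ∷ true  ∷ K) = refl
    same (false ∷ false ∷ K) = refl

liftCoefficients : {m : ℕ} → (Vec Bool m → ℚ) → (Vec Bool m → ℚ) → Vec Bool (suc (suc m)) → ℚ
liftCoefficients α β (a     ∷ true  ∷ K) = 0ℚ
liftCoefficients α β (true  ∷ false ∷ K) = α K
liftCoefficients α β (false ∷ false ∷ K) = β K

ψ-liftCoefficients : {m : ℕ} (α β : Vec Bool m → ℚ) (g : Bool) (G : Vec Bool m) →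
  ∑[ J ← allVecs (suc (suc m)) ] liftCoefficients α β J * ψX J (g ∷ G)
  ≡ (∑[ K ← allVecs m ] α K * (2^∣ K ∣ * boolℚ (peaksCovered false K G)))
    + (if g then 0ℚ else ∑[ K ← allVecs m ] β K * (2^∣ K ∣ * boolℚ (peaksCovered false K G)))
ψ-liftCoefficients {m} α β g G = begin
    ∑[ J ← allVecs (suc (suc m)) ] liftCoefficients α β J * ψX J (g ∷ G)
  ≡⟨ ∑-allVecs-2+ m _ ⟩
    ((∑[ K ← allVecs m ] 0ℚ * ψValue true true K (g ∷ G)) + with-1′)
      + ((∑[ K ← allVecs m ] 0ℚ * ψValue false true K (g ∷ G)) + (∑[ K ← allVecs m ] β K * ψValue false false K (g ∷ G)))
  ≡⟨ cong₂ _+_ (cong (_+ with-1′) (∑-zero (allVecs m) (λ K → ℚ.*-zeroˡ (ψValue true true K (g ∷ G)))))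
               (cong₂ _+_ (∑-zero (allVecs m) (λ K → ℚ.*-zeroˡ (ψValue false true K (g ∷ G)))) (first-peak g)) ⟩
    (0ℚ + with-1′) + (0ℚ + (if g then 0ℚ else without-1′))
  ≡⟨ solve 2 (λ a b → (con 0ℚ :+ a) :+ (con 0ℚ :+ b) := a :+ b) refl with-1′ (if g then 0ℚ else without-1′) ⟩
    with-1′ + (if g then 0ℚ else without-1′)
  ∎
  where
  with-1′ without-1′ : ℚ
  with-1′ = ∑[ K ← allVecs m ] α K * (2^∣ K ∣ * boolℚ (peaksCovered false K G))
  without-1′ = ∑[ K ← allVecs m ] β K * (2^∣ K ∣ * boolℚ (peaksCovered false K G))
  first-peak : ∀ g → ∑[ K ← allVecs m ] β K * ψValue false false K (g ∷ G) ≡ (if g then 0ℚ else without-1′)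
  first-peak true  = ∑-zero (allVecs m) (λ K → ℚ.*-zeroʳ (β K))
  first-peak false = refl

ψΣ-onto-ℙ : {m : ℕ} (z : Perm (suc (suc m)) → ℚ) → Inℙ (suc (suc m)) z → ∃ λ x → InΣD (suc (suc m)) x × ψ x ≈ z
ψΣ-onto-ℙ {m} z (c , z≈) =
  lc (allVecs _) c′ XD , (c′ , λ _ → refl) , λ u → trans (ψ-expansion (allVecs _) c′ (λ _ → refl) u)
                                                    (trans (realises (Peak u) (Peak-noConsec u)) (sym (z≈ u)))
  where
  h : Vec Bool (suc m) → ℚ
  h = peakExpansion (𝓕 (suc (suc m))) c
  peaked : Vec Bool m → ℚ
  peaked G = h (true ∷ (false ∷′ tail′ G))
  Sₚ : CoverageExpansion false peaked
  Sₚ = covered-span m peaked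
  Sₙ : CoverageExpansion false (λ G → h (false ∷ G) - peaked G)
  Sₙ = covered-span m (λ G → h (false ∷ G) - peaked G)
  c′ : Vec Bool (suc (suc m)) → ℚ
  c′ = liftCoefficients (rescaled Sₚ) (rescaled Sₙ)
  realises : ∀ P → T (noConsec P) → ∑[ J ← allVecs (suc (suc m)) ] c′ J * ψX J P ≡ h P
  realises (false ∷ G) nc = begin
      ∑[ J ← allVecs (suc (suc m)) ] c′ J * ψX J (false ∷ G)
    ≡⟨ ψ-liftCoefficients (rescaled Sₚ) (rescaled Sₙ) false G ⟩
      _
    ≡⟨ cong₂ _+_ (rescaled-expansion Sₚ G nc′) (rescaled-expansion Sₙ G nc′) ⟩
      peaked G + (h (false ∷ G) - peaked G)
    ≡⟨ solve 2 (λ p q → p :+ (q :- p) := q) refl (peaked G) (h (false ∷ G)) ⟩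
      h (false ∷ G)
    ∎
    where
    nc′ : T (noConsec G)
    nc′ = noConsec-tail false G nc
  realises (true ∷ G) nc = begin
      ∑[ J ← allVecs (suc (suc m)) ] c′ J * ψX J (true ∷ G)
    ≡⟨ ψ-liftCoefficients (rescaled Sₚ) (rescaled Sₙ) true G ⟩
      _
    ≡⟨ trans (ℚ.+-identityʳ _) (rescaled-expansion Sₚ G (noConsec-tail true G nc)) ⟩
      peaked G
    ≡⟨ cong (λ G → h (true ∷ G)) (sym (noConsec-after-true G nc)) ⟩
      h (true ∷ G)
    ∎

ψI-onto-ℙ̊ : {m : ℕ} (z : Perm (suc (suc m)) → ℚ) → Inℙ̊ (suc (suc m)) z → ∃ λ x → InI (suc (suc m)) x × ψ x ≈ z
ψI-onto-ℙ̊ {m} z (c , z≈) =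
  lc (idxI _) c′ XD , (c′ , λ _ → refl) , λ u → trans (ψ-expansion (idxI _) c′ (λ _ → refl) u)
                                               (trans (realises (Peak u) (Peak-noConsec u)) (sym (z≈ u)))
  where
  h : Vec Bool (suc m) → ℚ
  h = peakExpansion (𝓕̊ (suc (suc m))) c
  S : CoverageExpansion false (λ G → h (false ∷ G))
  S = covered-span m (λ G → h (false ∷ G))
  c′ : Vec Bool (suc (suc m)) → ℚ
  c′ = liftCoefficients (rescaled S) (λ _ → 0ℚ)
  supported : ∀ P J → (if has1'or1 J then c′ J * ψX J P else 0ℚ) ≡ c′ J * ψX J P
  supported P (true  ∷ b     ∷ K) = refl
  supported P (false ∷ true  ∷ K) = refl
  supported P (false ∷ false ∷ K) = sym (ℚ.*-zeroˡ (ψX (false ∷ false ∷ K) P))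
  realises : ∀ P → T (noConsec P) → ∑[ J ← idxI (suc (suc m)) ] c′ J * ψX J P ≡ h (remove1 P)
  realises (g ∷ G) nc = begin
      ∑[ J ← idxI (suc (suc m)) ] c′ J * ψX J (g ∷ G)
    ≡⟨ trans (∑-filter (allVecs (suc (suc m))) has1'or1 _) (∑-cong (allVecs (suc (suc m))) (supported (g ∷ G))) ⟩
      ∑[ J ← allVecs (suc (suc m)) ] c′ J * ψX J (g ∷ G)
    ≡⟨ ψ-liftCoefficients (rescaled S) (λ _ → 0ℚ) g G ⟩
      _
    ≡⟨ cong₂ _+_ (rescaled-expansion S G (noConsec-tail g G nc)) (nothing-without-1' g) ⟩
      h (false ∷ G) + 0ℚ
    ≡⟨ ℚ.+-identityʳ _ ⟩
      h (false ∷ G)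
    ∎
    where
    nothing-without-1' : ∀ g → (if g then 0ℚ else ∑[ K ← allVecs m ] 0ℚ * (2^∣ K ∣ * boolℚ (peaksCovered false K G))) ≡ 0ℚ
    nothing-without-1' true  = refl
    nothing-without-1' false = ∑-zero (allVecs m) (λ K → ℚ.*-zeroˡ (2^∣ K ∣ * boolℚ (peaksCovered false K G)))

φ-into-ℙ : {m : ℕ} (y : SPerm m → ℚ) → InΣB m y → Inℙ m (φ y)
φ-into-ℙ {m} y (c , y≈) = Inℙ-intro (φ y) (λ P → ∑[ K ← allVecs m ] c K * (2^∣ K ∣ * boolℚ (coveredᴮ K P)))
  λ v → trans (φ-cong y _ y≈ v) (trans (φ-lc (allVecs m) c XB v) (∑-cong (allVecs m) (λ K → cong (c K *_) (φ-X K v))))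

φ-onto-ℙ : {m : ℕ} (z : Perm m → ℚ) → Inℙ m z → ∃ λ y → InΣB m y × φ y ≈ z
φ-onto-ℙ {zero} z (c , z≈) = lc (allVecs 0) (λ _ → h []) XB , ((λ _ → h []) , λ _ → refl) , realises
  where
  h : Vec Bool 0 → ℚ
  h = peakExpansion (𝓕 0) c
  realises : ∀ v → φ (lc (allVecs 0) (λ _ → h []) XB) v ≡ z v
  realises v@(perm [] _) = trans (φ-lc (allVecs 0) (λ _ → h []) XB v)
    (trans (solve 1 (λ q → q :* (con 1ℚ :* con 1ℚ) :+ con 0ℚ := q) refl (h [])) (sym (z≈ v)))
φ-onto-ℙ {suc m} z (c , z≈) = lc (allVecs (suc m)) c′ XB , (c′ , λ _ → refl) , λ v → begin
    φ (lc (allVecs (suc m)) c′ XB) v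
  ≡⟨ trans (φ-lc (allVecs (suc m)) c′ XB v) (∑-cong (allVecs (suc m)) (λ K → cong (c′ K *_) (φ-X K v))) ⟩
    ∑[ K ← allVecs (suc m) ] c′ K * (2^∣ K ∣ * boolℚ (coveredᴮ K (Peak v)))
  ≡⟨ ∑-allVecs-suc m _ ⟩
    (∑[ K ← allVecs m ] 0ℚ * (two * 2^∣ K ∣ * boolℚ (peaksCovered true K (Peak v))))
      + (∑[ K ← allVecs m ] rescaled S K * (2^∣ K ∣ * boolℚ (peaksCovered false K (Peak v))))
  ≡⟨ cong₂ _+_ (∑-zero (allVecs m) (λ K → ℚ.*-zeroˡ (two * 2^∣ K ∣ * boolℚ (peaksCovered true K (Peak v)))))
               (rescaled-expansion S (Peak v) (Peak-noConsec v)) ⟩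
    0ℚ + h (Peak v)
  ≡⟨ trans (ℚ.+-identityˡ _) (sym (z≈ v)) ⟩
    z v
  ∎
  where
  h : Vec Bool m → ℚ
  h = peakExpansion (𝓕 (suc m)) c
  S : CoverageExpansion false h
  S = covered-span m h
  c′ : Vec Bool (suc m) → ℚ
  c′ (true  ∷ K) = 0ℚ
  c′ (false ∷ K) = rescaled S K

peaksCovered-below : {m : ℕ} (K : Vec Bool m) (P : Vec Bool (pred m)) → peaksCovered false K (false ∷′ P) ≡ coveredᴮ K P
peaksCovered-below []      P = refl
peaksCovered-below (b ∷ K) P = cong (_∧ peaksCovered b K P) (∨-zeroʳ b)

square-commutes : {m : ℕ} (x : DPerm (suc (suc m)) → ℚ) → InΣD (suc (suc m)) x → π-map (ψ x) ≈ φ (γ-map x)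
square-commutes {m} x (c , x≈) v = begin
    ψ x (lift12 v) - ψ x (lift21 v)
  ≡⟨ cong₂ _-_ (trans (ψ-expansion (allVecs _) c x≈ (lift12 v)) (∑-cong (allVecs _) (λ J → cong (λ P → c J * ψX J P) (Peak-lift12 v))))
               (trans (ψ-expansion (allVecs _) c x≈ (lift21 v)) (∑-cong (allVecs _) (λ J → cong (λ P → c J * ψX J P) (Peak-lift21 v)))) ⟩
    (∑[ J ← allVecs (suc (suc m)) ] c J * ψX J (false ∷ P′)) - (∑[ J ← allVecs (suc (suc m)) ] c J * ψX J (true ∷ P′))
  ≡⟨ sym (∑-- (allVecs (suc (suc m))) (λ J → c J * ψX J (false ∷ P′)) (λ J → c J * ψX J (true ∷ P′))) ⟩
    ∑[ J ← allVecs (suc (suc m)) ] (c J * ψX J (false ∷ P′) - c J * ψX J (true ∷ P′))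
  ≡⟨ ∑-cong (allVecs _) (λ J → trans (solve 3 (λ c p q → c :* p :- c :* q := c :* (p :- q)) refl (c J) _ _)
                                      (cong (c J *_) (peak-difference J))) ⟩
    ∑[ J ← allVecs (suc (suc m)) ] c J * φ (γX m J) v
  ≡⟨ sym (φ-lc (allVecs _) c (γX m) v) ⟩
    φ (lc (allVecs (suc (suc m))) c (γX m)) v
  ≡⟨ sym (φ-cong (γ-map x) _ (λ w → trans (γ-map-cong x _ x≈ w) (γ-map-basis c w)) v) ⟩
    φ (γ-map x) v
  ∎
  where
  P′ : Vec Bool m
  P′ = false ∷′ Peak v
  φ-zero : φ {m} zeroV v ≡ 0ℚ
  φ-zero = ∑-zero (allVecs m) (λ _ → refl)
  peak-difference : ∀ J → ψX J (false ∷ P′) - ψX J (true ∷ P′) ≡ φ (γX m J) v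
  peak-difference (true  ∷ true  ∷ K) = trans (ℚ.+-inverseʳ (ψX (true  ∷ true  ∷ K) (false ∷ P′))) (sym φ-zero)
  peak-difference (true  ∷ false ∷ K) = trans (ℚ.+-inverseʳ (ψX (true  ∷ false ∷ K) (false ∷ P′))) (sym φ-zero)
  peak-difference (false ∷ true  ∷ K) = trans (ℚ.+-inverseʳ (ψX (false ∷ true  ∷ K) (false ∷ P′))) (sym φ-zero)
  peak-difference (false ∷ false ∷ K) = begin
      2^∣ K ∣ * boolℚ (peaksCovered false K P′) - 0ℚ ≡⟨ ℚ.+-identityʳ _ ⟩
      2^∣ K ∣ * boolℚ (peaksCovered false K P′)      ≡⟨ cong (λ b → 2^∣ K ∣ * boolℚ b) (peaksCovered-below K (Peak v)) ⟩
      2^∣ K ∣ * boolℚ (coveredᴮ K (Peak v))          ≡⟨ sym (φ-X K v) ⟩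
      φ (XB K) v                                     ∎

theorem5p12 : (m : ℕ) → Diagram m
theorem5p12 m = record
  { γ         = γ-map
  ; γ-cong    = γ-map-cong
  ; γ-def     = γ-map-basis
  ; π         = π-map
  ; π-cong    = π-map-cong
  ; π-def     = π-map-basis
  ; I⊆ΣD      = InI⇒InΣD
  ; γ-ker→I   = γ-kernel⇒InI
  ; I→γ-ker   = InI⇒γ-kernel
  ; γ-into    = γ-into-ΣB
  ; γ-onto    = γ-onto-ΣB
  ; ℙ̊⊆ℙ       = ℙ̊⇒ℙ
  ; π-ker→ℙ̊   = π-kernel⇒ℙ̊
  ; ℙ̊→π-ker   = ℙ̊⇒π-kernel
  ; π-into    = π-into-ℙ
  ; π-onto    = π-onto-ℙ
  ; ψI-into   = ψI-into-ℙ̊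
  ; ψI-onto   = ψI-onto-ℙ̊
  ; ψΣ-into   = ψΣ-into-ℙ
  ; ψΣ-onto   = ψΣ-onto-ℙ
  ; φ-into    = φ-into-ℙ
  ; φ-onto    = φ-onto-ℙ
  ; square    = square-commutes
  }
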